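{- Let $G=(V,E)$ be a symmetric caterpillar with $n$ spine vertices $s_1,\dots,s_n$, where $L_i$ denotes the number of leaves attached to $s_i$, and let $L=\max_{1\le i\le n}L_i$. Then $IDI(G)=L$ if $L\ge 2$, and $IDI(G)=2$ if $L=1$.
   Context: A caterpillar is a tree containing a path, the spine, with vertices $s_1,\dots,s_n$ in order, such that every other vertex is a leaf adjacent to a spine vertex; $L_i\ge 0$ is the number of leaves adjacent to $s_i$, with $L_1,L_n\ge 1$ (an end of the spine with no attached leaves would itself be regarded as a leaf). The caterpillar is symmetric if $L_j=L_{n+1-j}$ for all $1\le j\le\lfloor n/2\rfloor$. For a connected graph $G=(V,E)$ of diameter $d$ and $f:V\to\mathbb{R}$, the string of $v$ under $f$ is the $d$-vector whose $i$-th coordinate is $\sum_{w:\ d(v,w)=i} f(w)$ ($d(\cdot,\cdot)$ = graph distance). $IDI(G)$ is the minimum $k$ such that some $f$ with $|f(V)|=k$ gives all vertices pairwise distinct strings.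
   Formalization: The labelings f in the definition of $IDI(G)$ take values in ℚ instead of ℝ. -}

module Defs where

open import Data.Bool using (Bool; true; false; if_then_else_; _∧_; _∨_)
open import Data.Nat as ℕ using (ℕ; zero; suc; _≡ᵇ_; _⊔_; _≤_)
open import Data.Fin as Fin using (Fin; toℕ; opposite)
import Data.Fin.Properties as FinP
open import Data.List using (List; []; _∷_; map; foldr; length; allFin; upTo; concatMap; _++_; deduplicate)
open import Data.Bool.ListAction using (any)
open import Data.Product using (Σ; _×_; _,_; Σ-syntax)
open import Data.Sum using (_⊎_; inj₁; inj₂)
import Data.Sum.Properties as SumP
import Data.Product.Properties as ProdP
open import Data.Rational as ℚ using (ℚ; 0ℚ)
import Data.Rational.Properties as ℚP
open import Relation.Nullary using (⌊_⌋)
open import Relation.Binary.PropositionalEquality using (_≡_)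
open import Relation.Binary.Definitions using (DecidableEquality)

-- Finite (simple, undirected) graphs given by an explicit list of all
-- vertices (each listed exactly once), decidable equality and a
-- Boolean adjacency relation.

record FinGraph : Set₁ where
  field
    V      : Set
    verts  : List V
    _≟V_   : DecidableEquality V
    adj    : V → V → Bool

module _ (G : FinGraph) where
  open FinGraph G

  reach : ℕ → V → V → Bool
  reach zero    u v = ⌊ u ≟V v ⌋
  reach (suc k) u v = reach k u v ∨ any (λ w → reach k u w ∧ adj w v) verts

  least : ℕ → (ℕ → Bool) → ℕ
  least zero    p = 0
  least (suc m) p = if p 0 then 0 else suc (least m (λ k → p (suc k)))

  -- graph distance (for a connected graph it is < |V|)
  dist : V → V → ℕ
  dist u v = least (length verts) (λ k → reach k u v)

  diam : ℕ
  diam = foldr (λ u acc → foldr (λ v acc' → dist u v ⊔ acc') acc verts) 0 verts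

  coord : (V → ℚ) → V → ℕ → ℚ
  coord f v i = foldr (λ w acc → if dist v w ≡ᵇ i then f w ℚ.+ acc else acc) 0ℚ verts

  string : (V → ℚ) → V → List ℚ
  string f v = map (λ i → coord f v (suc i)) (upTo diam)

  Distinguishing : (V → ℚ) → Set
  Distinguishing f = ∀ u v → string f u ≡ string f v → u ≡ v

  numValues : (V → ℚ) → ℕ
  numValues f = length (deduplicate ℚ._≟_ (map f verts))

  IsIDI : ℕ → Set
  IsIDI k = (Σ[ f ∈ (V → ℚ) ] (Distinguishing f × numValues f ≡ k))
          × (∀ f → Distinguishing f → k ≤ numValues f)

-- Caterpillars: spine s_0,…,s_{n-1} (Fin n), L i leaves attached to s_i.
-- Vertices: inj₁ i = spine vertex s_i; inj₂ (i , j) = j-th leaf of s_i.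

CatV : (n : ℕ) → (Fin n → ℕ) → Set
CatV n L = Fin n ⊎ Σ (Fin n) (λ i → Fin (L i))

catVerts : (n : ℕ) (L : Fin n → ℕ) → List (CatV n L)
catVerts n L = map inj₁ (allFin n)
            ++ concatMap (λ i → map (λ j → inj₂ (i , j)) (allFin (L i))) (allFin n)

catAdj : (n : ℕ) (L : Fin n → ℕ) → CatV n L → CatV n L → Bool
catAdj n L (inj₁ i) (inj₁ j) = (suc (toℕ i) ≡ᵇ toℕ j) ∨ (suc (toℕ j) ≡ᵇ toℕ i)
catAdj n L (inj₁ i) (inj₂ (j , _)) = ⌊ i Fin.≟ j ⌋
catAdj n L (inj₂ (i , _)) (inj₁ j) = ⌊ i Fin.≟ j ⌋
catAdj n L (inj₂ _) (inj₂ _) = false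

caterpillar : (n : ℕ) → (Fin n → ℕ) → FinGraph
caterpillar n L = record
  { V     = CatV n L
  ; verts = catVerts n L
  ; _≟V_  = SumP.≡-dec Fin._≟_ (ProdP.≡-dec Fin._≟_ Fin._≟_)
  ; adj   = catAdj n L
  }

maxLeaves : (n : ℕ) → (Fin n → ℕ) → ℕ
maxLeaves n L = foldr _⊔_ 0 (map L (allFin n))

-- A permutation of the vertices that preserves distances and f preserves every
-- string, so a distinguishing f forces it to be the identity. Swapping two leaves of one spine
-- vertex is such a permutation whenever f agrees on them; hence a distinguishing f is injective
-- on the leaves of each spine vertex and takes at least L values. A constant f is never
-- distinguishing, since the reflection of a symmetric caterpillar (or, for K₂, the swap of its
-- two vertices) moves some vertex.
--
-- Take f = N + c, where c is 1 at s₀, 0 at the other spine vertices and j at the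
-- j-th leaf of every spine vertex; it takes max (L, 2) values. For φ with φ 0 = 0, the sum
-- Σᵢ φ i · (i-th coordinate of the string of v) = Σ_w φ (d (v, w)) f w is determined by the
-- string: φ = [· > 0] gives Σ_{w ≠ v} f w, hence f v, and φ = id gives W v = Σ_w d (v, w) f w.
-- For a spine vertex, W sₜ = N W₀ t + W₁ t with W₁ t < N, and W₀ t = Σᵢ (Lᵢ + 1) |t - i| + Σ L
-- is a symmetric strictly convex function of t, so it fixes t up to t ↦ m - t; as W₁ t - t is
-- invariant under that reflection, W₁ fixes t. For a leaf ℓ at sₜ, W ℓ + 2 f ℓ = W sₜ + Σ f,
-- which recovers t, and then f ℓ recovers the leaf. Finally the first coordinate of a leaf is
-- f of its spine vertex, at most N + 1, while a spine vertex has two neighbours and first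
-- coordinate at least 2 N, except in K₂, where f separates the two vertices.

module Submission where

open import Defs
open import Data.Nat using (ℕ; suc; _≤_)
open import Data.Fin using (Fin; zero; fromℕ; opposite)
open import Relation.Binary.PropositionalEquality using (_≡_)
open import Data.Product using (_×_)

open import Algebra.Bundles using (CommutativeMonoid)
open import Algebra.Structures using (IsCommutativeMonoid)
open import Data.Bool using (Bool; true; false; if_then_else_; T)
open import Data.Bool.Properties using (T-∨; T-∧)
open import Data.Empty using (⊥-elim)
open import Data.Fin as Fin using (suc; toℕ)
import Data.Fin.Properties as Fin
open import Data.Fin.Permutation as Perm using (Permutation; Permutation′; _⟨$⟩ʳ_; _⟨$⟩ˡ_)
open import Data.List using (List; []; _∷_; _++_; map; foldr; concat; tabulate; allFin; length; lookup; applyUpTo; upTo; deduplicate)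
import Data.List.Properties as List
open import Data.List.Membership.Propositional using (_∈_; lose)
open import Data.List.Membership.Propositional.Properties
  using (∈-applyUpTo⁺; ∈-applyUpTo⁻; ∈-++⁺ˡ; ∈-++⁺ʳ; ∈-concat⁺′; ∈-allFin; ∈-lookup; ∈-map⁺; ∈-map⁻; ∈-deduplicate⁺; ∈-deduplicate⁻)
import Data.List.Relation.Unary.All as All
open import Data.List.Relation.Unary.AllPairs using ([]; _∷_)
open import Data.List.Relation.Unary.Any using (here; there; satisfied; index)
open import Data.List.Relation.Unary.Any.Properties using (any⁺; any⁻; lookup-index)
open import Data.List.Relation.Unary.Unique.Propositional using (Unique)
import Data.List.Relation.Unary.Unique.Propositional.Properties as Unique
open import Data.List.Relation.Unary.Unique.DecPropositional.Properties using (deduplicate-!)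
open import Data.Nat as ℕ using (zero; _+_; _*_; _∸_; _<_; _⊔_; ∣_-_∣; _≡ᵇ_; z≤n; s≤s)
import Data.Nat.Properties as ℕ
open import Data.Nat.Solver using (module +-*-Solver)
open +-*-Solver using (solve; _:=_; _:+_; _:*_; con)
open import Data.Product using (Σ; _,_; proj₁)
open import Data.Rational as ℚ using (ℚ; 0ℚ; 1ℚ)
import Data.Rational.Properties as ℚ
open import Algebra.Properties.Monoid.Mult ℚ.+-0-monoid using (×-homo-+) renaming (_×_ to _×ℚ_)
open import Data.Sum using (_⊎_; inj₁; inj₂)
open import Data.Sum.Properties using (inj₁-injective; inj₂-injective)
open import Function using (_∘_; case_of_; Equivalence)
open import Level using (0ℓ)
open import Relation.Binary.Definitions using (tri<; tri≈; tri>)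
open import Relation.Binary.PropositionalEquality using (refl; sym; trans; cong; cong₂; subst; module ≡-Reasoning)
open import Relation.Nullary using (¬_; Dec; yes; no)
open import Relation.Nullary.Decidable using (⌊_⌋; toWitness; fromWitness; decidable-stable)

-- Absolute differences of natural numbers

∣m-n∣≤m+n : ∀ m n → ∣ m - n ∣ ≤ m + n
∣m-n∣≤m+n m n = ℕ.≤-trans (ℕ.∣m-n∣≤m⊔n m n) (ℕ.m⊔n≤m+n m n)

∣m+n-m∣≡n : ∀ m n → ∣ m + n - m ∣ ≡ n
∣m+n-m∣≡n m n = trans (ℕ.∣-∣-comm (m + n) m) (ℕ.∣m-m+n∣≡n m n)

o+∣n-o∣≡n⊔∣n-[o+o]∣ : ∀ n o → o + ∣ n - o ∣ ≡ n ⊔ ∣ n - (o + o) ∣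
o+∣n-o∣≡n⊔∣n-[o+o]∣ n o with ℕ.≤-total o n
... | inj₁ o≤n with x , refl ← ℕ.m≤n⇒∃[o]m+o≡n o≤n = begin
  o + ∣ o + x - o ∣                ≡⟨ cong (o +_) (∣m+n-m∣≡n o x) ⟩
  o + x                            ≡⟨ ℕ.m≥n⇒m⊔n≡m (ℕ.≤-trans (∣m-n∣≤m+n x o) (ℕ.≤-reflexive (ℕ.+-comm x o))) ⟨
  (o + x) ⊔ ∣ x - o ∣              ≡⟨ cong ((o + x) ⊔_) (ℕ.∣m+n-m+o∣≡∣n-o∣ o x o) ⟨
  (o + x) ⊔ ∣ o + x - (o + o) ∣    ∎
  where open ≡-Reasoning
... | inj₂ n≤o with x , refl ← ℕ.m≤n⇒∃[o]m+o≡n n≤o = begin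
  (n + x) + ∣ n - n + x ∣                  ≡⟨ cong ((n + x) +_) (ℕ.∣m-m+n∣≡n n x) ⟩
  (n + x) + x                              ≡⟨ ℕ.+-comm (n + x) x ⟩
  x + (n + x)                              ≡⟨ ℕ.m≤n⇒m⊔n≡n (ℕ.≤-trans (ℕ.m≤m+n n x) (ℕ.m≤n+m (n + x) x)) ⟨
  n ⊔ (x + (n + x))                        ≡⟨ cong (n ⊔_) (trans (cong ∣ n -_∣ (ℕ.+-assoc n x (n + x))) (ℕ.∣m-m+n∣≡n n _)) ⟨
  n ⊔ ∣ n - (n + x) + (n + x) ∣            ∎
  where open ≡-Reasoning

-- The ℕ-form of |x| + |y| = max (|x - y|, |x + y|) at x = m - o, y = n - o.
∣m-o∣+∣n-o∣≡∣m-n∣⊔∣m+n-[o+o]∣ : ∀ m n o → ∣ m - o ∣ + ∣ n - o ∣ ≡ ∣ m - n ∣ ⊔ ∣ (m + n) - (o + o) ∣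
∣m-o∣+∣n-o∣≡∣m-n∣⊔∣m+n-[o+o]∣ m       n       zero    = begin
  ∣ m - 0 ∣ + ∣ n - 0 ∣        ≡⟨ cong₂ _+_ (ℕ.∣-∣-identityʳ m) (ℕ.∣-∣-identityʳ n) ⟩
  m + n                        ≡⟨ ℕ.m≤n⇒m⊔n≡n (∣m-n∣≤m+n m n) ⟨
  ∣ m - n ∣ ⊔ (m + n)          ≡⟨ cong (∣ m - n ∣ ⊔_) (ℕ.∣-∣-identityʳ (m + n)) ⟨
  ∣ m - n ∣ ⊔ ∣ m + n - 0 ∣    ∎
  where open ≡-Reasoning
∣m-o∣+∣n-o∣≡∣m-n∣⊔∣m+n-[o+o]∣ zero    n       (suc o) = o+∣n-o∣≡n⊔∣n-[o+o]∣ n (suc o)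
∣m-o∣+∣n-o∣≡∣m-n∣⊔∣m+n-[o+o]∣ (suc m) zero    (suc o) = begin
  ∣ m - o ∣ + suc o                              ≡⟨ ℕ.+-comm ∣ m - o ∣ (suc o) ⟩
  suc o + ∣ m - o ∣                              ≡⟨ o+∣n-o∣≡n⊔∣n-[o+o]∣ (suc m) (suc o) ⟩
  suc m ⊔ ∣ suc m - (suc o + suc o) ∣            ≡⟨ cong (λ k → suc m ⊔ ∣ k - (suc o + suc o) ∣) (ℕ.+-identityʳ (suc m)) ⟨
  suc m ⊔ ∣ suc m + 0 - (suc o + suc o) ∣        ∎
  where open ≡-Reasoning
∣m-o∣+∣n-o∣≡∣m-n∣⊔∣m+n-[o+o]∣ (suc m) (suc n) (suc o) =
  trans (∣m-o∣+∣n-o∣≡∣m-n∣⊔∣m+n-[o+o]∣ m n o) (cong (∣ m - n ∣ ⊔_) (sym (cong₂ ∣_-_∣ (ℕ.+-suc m n) (ℕ.+-suc o o))))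

∣n-[m∸n]∣≡∣m-[n+n]∣ : ∀ {m n} → n ≤ m → ∣ n - (m ∸ n) ∣ ≡ ∣ m - (n + n) ∣
∣n-[m∸n]∣≡∣m-[n+n]∣ {n = n} n≤m with x , refl ← ℕ.m≤n⇒∃[o]m+o≡n n≤m =
  trans (cong ∣ n -_∣ (ℕ.m+n∸m≡n n x)) (trans (ℕ.∣-∣-comm n x) (sym (ℕ.∣m+n-m+o∣≡∣n-o∣ n x n)))

m∸n≡o∸m⇒n+o≡m+m : ∀ {m n o} → n ≤ m → m ≤ o → m ∸ n ≡ o ∸ m → n + o ≡ m + m
m∸n≡o∸m⇒n+o≡m+m {m} {n} {o} n≤m m≤o gaps≡ = begin
  n + o                ≡⟨ cong (n +_) (ℕ.m∸n+n≡m m≤o) ⟨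
  n + ((o ∸ m) + m)    ≡⟨ cong (λ k → n + (k + m)) gaps≡ ⟨
  n + ((m ∸ n) + m)    ≡⟨ ℕ.+-assoc n (m ∸ n) m ⟨
  (n + (m ∸ n)) + m    ≡⟨ cong (_+ m) (ℕ.m+[n∸m]≡n n≤m) ⟩
  m + m                ∎
  where open ≡-Reasoning

∣m-n∣≡∣m-o∣⇒n≡o⊎n+o≡m+m : ∀ {m n o} → ∣ m - n ∣ ≡ ∣ m - o ∣ → n ≡ o ⊎ n + o ≡ m + m
∣m-n∣≡∣m-o∣⇒n≡o⊎n+o≡m+m {m} {n} {o} eq with ℕ.≤-total n m | ℕ.≤-total o m
... | inj₁ n≤m | inj₁ o≤m = inj₁ (ℕ.∸-cancelˡ-≡ n≤m o≤m
  (trans (sym (ℕ.m≤n⇒∣n-m∣≡n∸m n≤m)) (trans eq (ℕ.m≤n⇒∣n-m∣≡n∸m o≤m))))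
... | inj₂ m≤n | inj₂ m≤o = inj₁ (ℕ.∸-cancelʳ-≡ m≤n m≤o
  (trans (sym (ℕ.m≤n⇒∣m-n∣≡n∸m m≤n)) (trans eq (ℕ.m≤n⇒∣m-n∣≡n∸m m≤o))))
... | inj₁ n≤m | inj₂ m≤o = inj₂ (m∸n≡o∸m⇒n+o≡m+m n≤m m≤o
  (trans (sym (ℕ.m≤n⇒∣n-m∣≡n∸m n≤m)) (trans eq (ℕ.m≤n⇒∣m-n∣≡n∸m m≤o))))
... | inj₂ m≤n | inj₁ o≤m = inj₂ (trans (ℕ.+-comm n o) (m∸n≡o∸m⇒n+o≡m+m o≤m m≤n
  (trans (sym (ℕ.m≤n⇒∣n-m∣≡n∸m o≤m)) (trans (sym eq) (ℕ.m≤n⇒∣m-n∣≡n∸m m≤n)))))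

m+m≡n+n⇒m≡n : ∀ {m n} → m + m ≡ n + n → m ≡ n
m+m≡n+n⇒m≡n {m} {n} eq with ℕ.<-cmp m n
... | tri< m<n _ _ = ⊥-elim (ℕ.<-irrefl eq (ℕ.+-mono-< m<n m<n))
... | tri≈ _ m≡n _ = m≡n
... | tri> _ _ n<m = ⊥-elim (ℕ.<-irrefl (sym eq) (ℕ.+-mono-< n<m n<m))

N*a+b<N*c+d : ∀ N {a b c d} → a < c → b < N → N * a + b < N * c + d
N*a+b<N*c+d N {a} {b} {c} {d} a<c b<N = begin-strict
  N * a + b        <⟨ ℕ.+-monoʳ-< (N * a) b<N ⟩
  N * a + N        ≡⟨ trans (ℕ.+-comm (N * a) N) (sym (ℕ.*-suc N a)) ⟩
  N * suc a        ≤⟨ ℕ.*-monoʳ-≤ N a<c ⟩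
  N * c            ≤⟨ ℕ.m≤m+n (N * c) d ⟩
  N * c + d        ∎
  where open ℕ.≤-Reasoning

N*a+b≡N*c+d⇒a≡c : ∀ N {a b c d} → b < N → d < N → N * a + b ≡ N * c + d → a ≡ c
N*a+b≡N*c+d⇒a≡c N {a} {b} {c} {d} b<N d<N eq with ℕ.<-cmp a c
... | tri< a<c _ _ = ⊥-elim (ℕ.<-irrefl eq (N*a+b<N*c+d N a<c b<N))
... | tri≈ _ a≡c _ = a≡c
... | tri> _ _ c<a = ⊥-elim (ℕ.<-irrefl (sym eq) (N*a+b<N*c+d N c<a d<N))

<⊔⇒< : ∀ {m n o} → o ≤ m → m < n ⊔ o → m < n
<⊔⇒< {m} {n} {o} o≤m m<n⊔o with ℕ.≤-total n o
... | inj₁ n≤o = ⊥-elim (ℕ.<⇒≱ (subst (m <_) (ℕ.m≤n⇒m⊔n≡n n≤o) m<n⊔o) o≤m)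
... | inj₂ o≤n = subst (m <_) (ℕ.m≥n⇒m⊔n≡m o≤n) m<n⊔o

∣m-1+n∣≡1+∣m-n∣ : ∀ {m n} → m ≤ n → ∣ m - suc n ∣ ≡ suc ∣ m - n ∣
∣m-1+n∣≡1+∣m-n∣ {zero}  z≤n       = refl
∣m-1+n∣≡1+∣m-n∣ {suc m} (s≤s m≤n) = ∣m-1+n∣≡1+∣m-n∣ m≤n

∣1+m-n∣≡1+∣m-n∣ : ∀ {m n} → n ≤ m → ∣ suc m - n ∣ ≡ suc ∣ m - n ∣
∣1+m-n∣≡1+∣m-n∣ {m} {n} n≤m = trans (ℕ.∣-∣-comm (suc m) n) (trans (∣m-1+n∣≡1+∣m-n∣ n≤m) (cong suc (ℕ.∣-∣-comm n m)))

∣m-n∣≡1+∣m-1+n∣ : ∀ {m n} → n < m → ∣ m - n ∣ ≡ suc ∣ m - suc n ∣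
∣m-n∣≡1+∣m-1+n∣ (s≤s n≤m) = ∣1+m-n∣≡1+∣m-n∣ n≤m

∣m∸n-m∸o∣≡∣n-o∣ : ∀ {m n o} → n ≤ m → o ≤ m → ∣ (m ∸ n) - (m ∸ o) ∣ ≡ ∣ n - o ∣
∣m∸n-m∸o∣≡∣n-o∣ {m} {n} {o} n≤m o≤m = begin
  ∣ (m ∸ n) - (m ∸ o) ∣                          ≡⟨ ℕ.∣m+n-m+o∣≡∣n-o∣ (n + o) (m ∸ n) (m ∸ o) ⟨
  ∣ (n + o) + (m ∸ n) - (n + o) + (m ∸ o) ∣      ≡⟨ cong₂ ∣_-_∣ (shift n o n≤m) (trans (cong (_+ (m ∸ o)) (ℕ.+-comm n o)) (shift o n o≤m)) ⟩
  ∣ m + o - m + n ∣                              ≡⟨ ℕ.∣m+n-m+o∣≡∣n-o∣ m o n ⟩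
  ∣ o - n ∣                                      ≡⟨ ℕ.∣-∣-comm o n ⟩
  ∣ n - o ∣                                      ∎
  where
  open ≡-Reasoning
  shift : ∀ x y → x ≤ m → (x + y) + (m ∸ x) ≡ m + y
  shift x y x≤m = trans (ℕ.+-assoc x y _) (trans (cong (x +_) (ℕ.+-comm y _)) (trans (sym (ℕ.+-assoc x _ y)) (cong (_+ y) (ℕ.m+[n∸m]≡n x≤m))))

if-≡ᵇ-refl : ∀ {A : Set} d (x y : A) → (if d ≡ᵇ d then x else y) ≡ x
if-≡ᵇ-refl zero    x y = refl
if-≡ᵇ-refl (suc d) x y = if-≡ᵇ-refl d x y

if-≡ᵇ-≢ : ∀ {A : Set} {d k} (x y : A) → ¬ d ≡ k → (if d ≡ᵇ k then x else y) ≡ y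
if-≡ᵇ-≢ {d = d} {k} x y d≢k with d ≡ᵇ k in eq
... | true  = ⊥-elim (d≢k (ℕ.≡ᵇ⇒≡ d k (subst T (sym eq) _)))
... | false = refl

-- Maxima and duplicate-free lists

module _ {X : Set} (h : X → ℕ) where

  ∈⇒≤foldr-⊔ : ∀ a xs {x} → x ∈ xs → h x ≤ foldr (λ y → h y ⊔_) a xs
  ∈⇒≤foldr-⊔ a (y ∷ ys) (here refl) = ℕ.m≤m⊔n (h y) _
  ∈⇒≤foldr-⊔ a (y ∷ ys) (there x∈ys) = ℕ.≤-trans (∈⇒≤foldr-⊔ a ys x∈ys) (ℕ.m≤n⊔m (h y) _)

  seed≤foldr-⊔ : ∀ a xs → a ≤ foldr (λ y → h y ⊔_) a xs
  seed≤foldr-⊔ a []       = ℕ.≤-refl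
  seed≤foldr-⊔ a (y ∷ ys) = ℕ.≤-trans (seed≤foldr-⊔ a ys) (ℕ.m≤n⊔m (h y) _)

L≤maxLeaves : ∀ n (L : Fin n → ℕ) i → L i ≤ maxLeaves n L
L≤maxLeaves n L i = ∈⇒≤foldr-⊔ (λ x → x) 0 (map L (allFin n)) (∈-map⁺ L (∈-allFin i))

maxLeaves-lub : ∀ n (L : Fin n → ℕ) {v} → (∀ i → L i ≤ v) → maxLeaves n L ≤ v
maxLeaves-lub n L {v} L≤v = go (map L (allFin n)) (λ x∈ → case ∈-map⁻ L x∈ of λ { (i , _ , refl) → L≤v i })
  where
  go : ∀ xs → (∀ {x} → x ∈ xs → x ≤ v) → foldr _⊔_ 0 xs ≤ v
  go []       _   = z≤n
  go (x ∷ xs) xs≤ = ℕ.⊔-lub (xs≤ (here refl)) (go xs (xs≤ ∘ there))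

<foldr-⊔⇒ : ∀ {j} xs → j < foldr _⊔_ 0 xs → Σ ℕ λ x → x ∈ xs × j < x
<foldr-⊔⇒ {j} (x ∷ xs) j< with ℕ.⊔-sel x (foldr _⊔_ 0 xs)
... | inj₁ ⊔≡x = x , here refl , subst (j <_) ⊔≡x j<
... | inj₂ ⊔≡r with y , y∈ , j<y ← <foldr-⊔⇒ xs (subst (j <_) ⊔≡r j<) = y , there y∈ , j<y

<maxLeaves⇒<L : ∀ n (L : Fin n → ℕ) {j} → j < maxLeaves n L → Σ (Fin n) λ i → j < L i
<maxLeaves⇒<L n L j<max with x , x∈ , j<x ← <foldr-⊔⇒ (map L (allFin n)) j<max with i , _ , refl ← ∈-map⁻ L x∈ = i , j<x

module _ {X : Set} where

  Unique-lookup-injective : ∀ {xs : List X} → Unique xs → ∀ {p q} → lookup xs p ≡ lookup xs q → p ≡ q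
  Unique-lookup-injective (x∉ ∷ u) {zero}  {zero}  _  = refl
  Unique-lookup-injective (x∉ ∷ u) {zero}  {suc q} eq = ⊥-elim (All.lookup x∉ (∈-lookup q) eq)
  Unique-lookup-injective (x∉ ∷ u) {suc p} {zero}  eq = ⊥-elim (All.lookup x∉ (∈-lookup p) (sym eq))
  Unique-lookup-injective (x∉ ∷ u) {suc p} {suc q} eq = cong suc (Unique-lookup-injective u eq)

  Unique⇒length≤ : ∀ {xs ys : List X} → Unique xs → (∀ {x} → x ∈ xs → x ∈ ys) → length xs ≤ length ys
  Unique⇒length≤ {xs} {ys} u xs⊆ys = Fin.injective⇒≤ injective
    where
    position : Fin (length xs) → Fin (length ys)
    position p = index (xs⊆ys (∈-lookup p))
    injective : ∀ {p q} → position p ≡ position q → p ≡ q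
    injective {p} {q} eq = Unique-lookup-injective u (begin
      lookup xs p             ≡⟨ lookup-index (xs⊆ys (∈-lookup p)) ⟩
      lookup ys (position p)  ≡⟨ cong (lookup ys) eq ⟩
      lookup ys (position q)  ≡⟨ lookup-index (xs⊆ys (∈-lookup q)) ⟨
      lookup xs q             ∎)
      where open ≡-Reasoning

-- Finite sums

leaf-injective : ∀ {n L i} {a b : Fin (L i)} → _≡_ {A = CatV n L} (inj₂ (i , a)) (inj₂ (i , b)) → a ≡ b
leaf-injective refl = refl

module FinSum {A : Set} {_∙_ : A → A → A} {ε : A}
              (isCM : IsCommutativeMonoid _≡_ _∙_ ε) where

  commutativeMonoid : CommutativeMonoid 0ℓ 0ℓ
  commutativeMonoid = record { isCommutativeMonoid = isCM }

  open CommutativeMonoid commutativeMonoid using (assoc; identityˡ; identityʳ; commutativeSemigroup)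
  open import Algebra.Properties.CommutativeSemigroup commutativeSemigroup using (interchange)
  open import Algebra.Properties.CommutativeMonoid.Sum commutativeMonoid public
    using (sum; sum-cong-≗; ∑-distrib-+; ∑-comm; ∑-permute; sum-replicate-zero)

  sum-zero : ∀ {n} {F : Fin n → A} → (∀ i → F i ≡ ε) → sum F ≡ ε
  sum-zero {n} F≡ε = trans (sum-cong-≗ F≡ε) (sum-replicate-zero n)

  sum-single : ∀ {n} (F : Fin n → A) t → (∀ i → ¬ i ≡ t → F i ≡ ε) → sum F ≡ F t
  sum-single F zero    F≡ε = trans (cong (F zero ∙_) (sum-zero (λ i → F≡ε (suc i) λ ()))) (identityʳ _)
  sum-single F (suc t) F≡ε = trans (cong₂ _∙_ (F≡ε zero λ ()) (sum-single (F ∘ suc) t F≡ε′)) (identityˡ _)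
    where F≡ε′ = λ i i≢t → F≡ε (suc i) (i≢t ∘ Fin.suc-injective)

  listSum : {X : Set} → List X → (X → A) → A
  listSum xs F = foldr (λ x → F x ∙_) ε xs

  listSum-++ : {X : Set} (xs ys : List X) (F : X → A) → listSum (xs ++ ys) F ≡ listSum xs F ∙ listSum ys F
  listSum-++ []       ys F = sym (identityˡ _)
  listSum-++ (x ∷ xs) ys F = trans (cong (F x ∙_) (listSum-++ xs ys F)) (sym (assoc _ _ _))

  listSum-map : {X Y : Set} (g : X → Y) (xs : List X) (F : Y → A) → listSum (map g xs) F ≡ listSum xs (F ∘ g)
  listSum-map g []       F = refl
  listSum-map g (x ∷ xs) F = cong (F (g x) ∙_) (listSum-map g xs F)

  listSum-concat : {X : Set} (xss : List (List X)) (F : X → A) → listSum (concat xss) F ≡ listSum xss (λ xs → listSum xs F)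
  listSum-concat []         F = refl
  listSum-concat (xs ∷ xss) F = trans (listSum-++ xs (concat xss) F) (cong (listSum xs F ∙_) (listSum-concat xss F))

  listSum-tabulate : {X : Set} {n : ℕ} (g : Fin n → X) (F : X → A) → listSum (tabulate g) F ≡ sum (F ∘ g)
  listSum-tabulate {n = zero}  g F = refl
  listSum-tabulate {n = suc n} g F = cong (F (g zero) ∙_) (listSum-tabulate (g ∘ suc) F)

  foldr-if≡listSum : {X : Set} (xs : List X) (b : X → Bool) (F : X → A) →
    foldr (λ x acc → if b x then F x ∙ acc else acc) ε xs ≡ listSum xs (λ x → if b x then F x else ε)
  foldr-if≡listSum []       b F = refl
  foldr-if≡listSum (x ∷ xs) b F with b x
  ... | true  = cong (F x ∙_) (foldr-if≡listSum xs b F)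
  ... | false = trans (foldr-if≡listSum xs b F) (sym (identityˡ _))

  catSum : (n : ℕ) (L : Fin n → ℕ) → (CatV n L → A) → A
  catSum n L F = sum (λ i → F (inj₁ i) ∙ sum (λ j → F (inj₂ (i , j))))

  module _ {n : ℕ} {L : Fin n → ℕ} where

    listSum-catVerts : (F : CatV n L → A) → listSum (catVerts n L) F ≡ catSum n L F
    listSum-catVerts F = begin
      listSum (map inj₁ (allFin n) ++ concat (map leaves (allFin n))) F
        ≡⟨ listSum-++ (map inj₁ (allFin n)) _ F ⟩
      listSum (map inj₁ (allFin n)) F ∙ listSum (concat (map leaves (allFin n))) F
        ≡⟨ cong₂ _∙_ (trans (listSum-map inj₁ (allFin n) F) (listSum-tabulate (λ i → i) (F ∘ inj₁))) leaf-part ⟩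
      sum (λ i → F (inj₁ i)) ∙ sum (λ i → sum (λ j → F (inj₂ (i , j))))
        ≡⟨ ∑-distrib-+ (λ i → F (inj₁ i)) _ ⟨
      catSum n L F ∎
      where
      open ≡-Reasoning
      leaves : Fin n → List (CatV n L)
      leaves i = map (λ j → inj₂ (i , j)) (allFin (L i))
      leaf-part : listSum (concat (map leaves (allFin n))) F ≡ sum (λ i → sum (λ j → F (inj₂ (i , j))))
      leaf-part = begin
        listSum (concat (map leaves (allFin n))) F    ≡⟨ listSum-concat (map leaves (allFin n)) F ⟩
        listSum (map leaves (allFin n)) (λ xs → listSum xs F) ≡⟨ listSum-map leaves (allFin n) _ ⟩
        listSum (allFin n) (λ i → listSum (leaves i) F)     ≡⟨ listSum-tabulate (λ i → i) (λ i → listSum (leaves i) F) ⟩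
        sum (λ i → listSum (leaves i) F)
          ≡⟨ sum-cong-≗ (λ i → trans (listSum-map _ (allFin (L i)) F) (listSum-tabulate (λ j → j) (λ j → F (inj₂ (i , j))))) ⟩
        sum (λ i → sum (λ j → F (inj₂ (i , j))))             ∎

    catSum-cong : {F G : CatV n L → A} → (∀ w → F w ≡ G w) → catSum n L F ≡ catSum n L G
    catSum-cong F≗G = sum-cong-≗ (λ i → cong₂ _∙_ (F≗G (inj₁ i)) (sum-cong-≗ (λ j → F≗G (inj₂ (i , j)))))

    catSum-distrib : (F G : CatV n L → A) → catSum n L (λ w → F w ∙ G w) ≡ catSum n L F ∙ catSum n L G
    catSum-distrib F G = trans (sum-cong-≗ regroup) (∑-distrib-+ (λ i → F (inj₁ i) ∙ sum (λ j → F (inj₂ (i , j)))) _)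
      where
      regroup : ∀ i → (F (inj₁ i) ∙ G (inj₁ i)) ∙ sum (λ j → F (inj₂ (i , j)) ∙ G (inj₂ (i , j)))
                    ≡ (F (inj₁ i) ∙ sum (λ j → F (inj₂ (i , j)))) ∙ (G (inj₁ i) ∙ sum (λ j → G (inj₂ (i , j))))
      regroup i = trans (cong (_ ∙_) (∑-distrib-+ (λ j → F (inj₂ (i , j))) _)) (interchange _ _ _ _)

    catSum-∑-comm : ∀ {k} (K : Fin k → CatV n L → A) → catSum n L (λ w → sum (λ x → K x w)) ≡ sum (λ x → catSum n L (K x))
    catSum-∑-comm K = begin
      sum (λ i → sum (λ x → K x (inj₁ i)) ∙ sum (λ j → sum (λ x → K x (inj₂ (i , j)))))
        ≡⟨ sum-cong-≗ (λ i → cong (_ ∙_) (∑-comm (λ j x → K x (inj₂ (i , j))))) ⟩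
      sum (λ i → sum (λ x → K x (inj₁ i)) ∙ sum (λ x → sum (λ j → K x (inj₂ (i , j)))))
        ≡⟨ sum-cong-≗ (λ i → ∑-distrib-+ (λ x → K x (inj₁ i)) (λ x → sum (λ j → K x (inj₂ (i , j))))) ⟨
      sum (λ i → sum (λ x → K x (inj₁ i) ∙ sum (λ j → K x (inj₂ (i , j)))))
        ≡⟨ ∑-comm (λ i x → K x (inj₁ i) ∙ sum (λ j → K x (inj₂ (i , j)))) ⟩
      sum (λ x → catSum n L (K x)) ∎
      where open ≡-Reasoning

    catSum-single : (F : CatV n L → A) (v : CatV n L) → (∀ w → ¬ w ≡ v → F w ≡ ε) → catSum n L F ≡ F v
    catSum-single F (inj₁ t) F≡ε = begin
      catSum n L F
        ≡⟨ sum-single _ t (λ i i≢t → trans (cong₂ _∙_ (F≡ε (inj₁ i) (i≢t ∘ inj₁-injective)) (leaves-zero i)) (identityˡ ε)) ⟩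
      F (inj₁ t) ∙ sum (λ j → F (inj₂ (t , j)))       ≡⟨ cong (F (inj₁ t) ∙_) (leaves-zero t) ⟩
      F (inj₁ t) ∙ ε                                  ≡⟨ identityʳ _ ⟩
      F (inj₁ t)                                      ∎
      where
      open ≡-Reasoning
      leaves-zero : ∀ i → sum (λ j → F (inj₂ (i , j))) ≡ ε
      leaves-zero i = sum-zero (λ j → F≡ε (inj₂ (i , j)) λ ())
    catSum-single F (inj₂ (t , a)) F≡ε = begin
      catSum n L F
        ≡⟨ sum-single _ t (λ i i≢t → trans (cong₂ _∙_ (F≡ε (inj₁ i) λ ()) (sum-zero (λ j → F≡ε (inj₂ (i , j)) (i≢t ∘ cong proj₁ ∘ inj₂-injective)))) (identityˡ ε)) ⟩
      F (inj₁ t) ∙ sum (λ j → F (inj₂ (t , j)))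
        ≡⟨ cong₂ _∙_ (F≡ε (inj₁ t) λ ()) (sum-single _ a (λ j j≢a → F≡ε (inj₂ (t , j)) (j≢a ∘ leaf-injective))) ⟩
      ε ∙ F (inj₂ (t , a))                            ≡⟨ identityˡ _ ⟩
      F (inj₂ (t , a))                                ∎
      where
      open ≡-Reasoning

module ℚSum = FinSum ℚ.+-0-isCommutativeMonoid

module ℕSum where
  open FinSum ℕ.+-0-isCommutativeMonoid public
  open import Algebra.Properties.Semiring.Sum ℕ.+-*-semiring public using (*-distribˡ-sum)

  sum-const : ∀ n k → sum {n} (λ _ → k) ≡ n * k
  sum-const zero    k = refl
  sum-const (suc n) k = cong (k +_) (sum-const n k)

  sum-mono : ∀ {n} {F G : Fin n → ℕ} → (∀ i → F i ≤ G i) → sum F ≤ sum G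
  sum-mono {zero}  F≤G = z≤n
  sum-mono {suc n} F≤G = ℕ.+-mono-≤ (F≤G zero) (sum-mono (F≤G ∘ suc))

  sum-mono-< : ∀ {n} {F G : Fin n → ℕ} → (∀ i → F i ≤ G i) → ∀ t → F t < G t → sum F < sum G
  sum-mono-< F≤G zero    Ft<Gt = ℕ.+-mono-<-≤ Ft<Gt (sum-mono (F≤G ∘ suc))
  sum-mono-< F≤G (suc t) Ft<Gt = ℕ.+-mono-≤-< (F≤G zero) (sum-mono-< (F≤G ∘ suc) t Ft<Gt)

  weightedSum : (ℕ → ℕ) → ℕ → (ℕ → ℕ) → ℕ
  weightedSum φ D a = sum {suc D} (λ i → φ (toℕ i) * a (toℕ i))

  weightedSum-cong : ∀ φ D {a b} → φ 0 ≡ 0 → (∀ i → i < D → a (suc i) ≡ b (suc i)) → weightedSum φ D a ≡ weightedSum φ D b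
  weightedSum-cong φ D {a} {b} φ0≡0 a≗b = cong₂ _+_
    (trans (cong (_* a 0) φ0≡0) (cong (_* b 0) (sym φ0≡0)))
    (sum-cong-≗ (λ i → cong (φ (suc (toℕ i)) *_) (a≗b (toℕ i) (Fin.toℕ<n i))))

  weightedSum-indicator : ∀ φ {D d} x → d ≤ D → weightedSum φ D (λ i → if d ≡ᵇ i then x else 0) ≡ φ d * x
  weightedSum-indicator φ {D} {d} x d≤D = trans (sum-single _ t off-t) at-t
    where
    t : Fin (suc D)
    t = Fin.fromℕ< (s≤s d≤D)
    off-t : ∀ i → ¬ i ≡ t → φ (toℕ i) * (if d ≡ᵇ toℕ i then x else 0) ≡ 0
    off-t i i≢t = trans (cong (φ (toℕ i) *_) (if-≡ᵇ-≢ x 0 λ d≡i → i≢t (Fin.toℕ-injective (trans (sym d≡i) (sym (Fin.toℕ-fromℕ< _))))))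
                        (ℕ.*-zeroʳ (φ (toℕ i)))
    at-t : φ (toℕ t) * (if d ≡ᵇ toℕ t then x else 0) ≡ φ d * x
    at-t rewrite Fin.toℕ-fromℕ< (s≤s d≤D) = cong (φ d *_) (if-≡ᵇ-refl d x 0)

  module _ {n : ℕ} {L : Fin n → ℕ} where

    catSum-mono : {F G : CatV n L → ℕ} → (∀ w → F w ≤ G w) → catSum n L F ≤ catSum n L G
    catSum-mono F≤G = sum-mono (λ i → ℕ.+-mono-≤ (F≤G (inj₁ i)) (sum-mono (λ j → F≤G (inj₂ (i , j)))))

    catSum-scale : ∀ k (F : CatV n L → ℕ) → catSum n L (λ w → k * F w) ≡ k * catSum n L F
    catSum-scale k F = sym (trans (*-distribˡ-sum k (λ i → F (inj₁ i) + sum (λ j → F (inj₂ (i , j))))) (sum-cong-≗ λ i →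
      trans (ℕ.*-distribˡ-+ k (F (inj₁ i)) _) (cong (k * F (inj₁ i) +_) (*-distribˡ-sum k (λ j → F (inj₂ (i , j)))))))

toℚ : ℕ → ℚ
toℚ k = k ×ℚ 1ℚ

toℚ-+ : ∀ a b → toℚ (a + b) ≡ toℚ a ℚ.+ toℚ b
toℚ-+ a b = ×-homo-+ 1ℚ a b

toℚ-sum : ∀ {n} (F : Fin n → ℕ) → toℚ (ℕSum.sum F) ≡ ℚSum.sum (toℚ ∘ F)
toℚ-sum {zero}  F = refl
toℚ-sum {suc n} F = trans (toℚ-+ (F zero) _) (cong (toℚ (F zero) ℚ.+_) (toℚ-sum (F ∘ suc)))

toℚ-catSum : ∀ {n L} (F : CatV n L → ℕ) → toℚ (ℕSum.catSum n L F) ≡ ℚSum.catSum n L (toℚ ∘ F)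
toℚ-catSum {n} {L} F = trans (toℚ-sum (λ i → F (inj₁ i) + ℕSum.sum (λ j → F (inj₂ (i , j)))))
  (ℚSum.sum-cong-≗ λ i → trans (toℚ-+ (F (inj₁ i)) _) (cong (toℚ (F (inj₁ i)) ℚ.+_) (toℚ-sum (λ j → F (inj₂ (i , j))))))

toℚ-<-suc : ∀ k → toℚ k ℚ.< toℚ (suc k)
toℚ-<-suc k = subst (ℚ._< toℚ (suc k)) (ℚ.+-identityˡ (toℚ k)) (ℚ.+-monoˡ-< (toℚ k) (ℚ.positive⁻¹ 1ℚ))

toℚ-< : ∀ {a b} → a < b → toℚ a ℚ.< toℚ b
toℚ-< {a} {suc b} (s≤s a≤b) with ℕ.m≤n⇒m<n∨m≡n a≤b
... | inj₁ a<b  = ℚ.<-trans (toℚ-< a<b) (toℚ-<-suc b)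
... | inj₂ refl = toℚ-<-suc a

toℚ-injective : ∀ {a b} → toℚ a ≡ toℚ b → a ≡ b
toℚ-injective {a} {b} eq with ℕ.<-cmp a b
... | tri< a<b _ _ = ⊥-elim (ℚ.<-irrefl eq (toℚ-< a<b))
... | tri≈ _ a≡b _ = a≡b
... | tri> _ _ b<a = ⊥-elim (ℚ.<-irrefl (sym eq) (toℚ-< b<a))

-- Symmetric weights on a path

module SymmetricWeights (m : ℕ) (w : Fin (suc m) → ℕ) (w-sym : ∀ i → w (opposite i) ≡ w i) where
  open ℕSum using (sum; sum-cong-≗; ∑-permute; ∑-distrib-+; sum-mono; sum-mono-<)

  ∑-reflect : ∀ (φ : ℕ → ℕ) {a} → a ≤ m → sum (λ i → w i * φ ∣ a - toℕ i ∣) ≡ sum (λ i → w i * φ ∣ (m ∸ a) - toℕ i ∣)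
  ∑-reflect φ {a} a≤m = trans (∑-permute (λ i → w i * φ ∣ a - toℕ i ∣) Perm.reverse) (sum-cong-≗ pointwise)
    where
    pointwise : ∀ i → w (opposite i) * φ ∣ a - toℕ (opposite i) ∣ ≡ w i * φ ∣ (m ∸ a) - toℕ i ∣
    pointwise i = cong₂ (λ x y → x * φ y) (w-sym i) (begin
      ∣ a - toℕ (opposite i) ∣          ≡⟨ cong₂ ∣_-_∣ (ℕ.m∸[m∸n]≡n a≤m) (sym (Fin.opposite-prop i)) ⟨
      ∣ m ∸ (m ∸ a) - m ∸ toℕ i ∣       ≡⟨ ∣m∸n-m∸o∣≡∣n-o∣ (ℕ.m∸n≤m m a) (Fin.toℕ≤pred[n] i) ⟩
      ∣ m ∸ a - toℕ i ∣                 ∎)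
      where open ≡-Reasoning

  module StrictConvexity (w-pos : ∀ i → 1 ≤ w i) where

    F : ℕ → ℕ
    F a = sum (λ i → w i * ∣ a - toℕ i ∣)

    e : ℕ → ℕ
    e x = ∣ m - (x + x) ∣

    H : ℕ → ℕ
    H u = sum (λ i → w i * (u ⊔ e (toℕ i)))

    -- Averaging F with its reflection turns it into a function of e alone.
    F+F≡H∘e : ∀ {a} → a ≤ m → F a + F a ≡ H (e a)
    F+F≡H∘e {a} a≤m = begin
      F a + F a
        ≡⟨ cong (F a +_) (∑-reflect (λ x → x) a≤m) ⟩
      F a + sum (λ i → w i * ∣ (m ∸ a) - toℕ i ∣)
        ≡⟨ ∑-distrib-+ (λ i → w i * ∣ a - toℕ i ∣) (λ i → w i * ∣ (m ∸ a) - toℕ i ∣) ⟨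
      sum (λ i → w i * ∣ a - toℕ i ∣ + w i * ∣ (m ∸ a) - toℕ i ∣)
        ≡⟨ sum-cong-≗ (λ i → trans (sym (ℕ.*-distribˡ-+ (w i) ∣ a - toℕ i ∣ ∣ (m ∸ a) - toℕ i ∣)) (cong (w i *_) (pointwise i))) ⟩
      H (e a) ∎
      where
      open ≡-Reasoning
      pointwise : ∀ i → ∣ a - toℕ i ∣ + ∣ (m ∸ a) - toℕ i ∣ ≡ e a ⊔ e (toℕ i)
      pointwise i = trans (∣m-o∣+∣n-o∣≡∣m-n∣⊔∣m+n-[o+o]∣ a (m ∸ a) (toℕ i))
        (cong₂ _⊔_ (∣n-[m∸n]∣≡∣m-[n+n]∣ a≤m) (cong (λ k → ∣ k - (toℕ i + toℕ i) ∣) (ℕ.m+[n∸m]≡n a≤m)))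

    H-strict : ∀ t {u} → e (toℕ t) < u → H (e (toℕ t)) < H u
    H-strict t {u} et<u = sum-mono-< (λ i → ℕ.*-monoʳ-≤ (w i) (ℕ.⊔-monoˡ-≤ (e (toℕ i)) (ℕ.<⇒≤ et<u))) t (begin-strict
      w t * (e (toℕ t) ⊔ e (toℕ t))   ≡⟨ cong (w t *_) (ℕ.⊔-idem (e (toℕ t))) ⟩
      w t * e (toℕ t)                 <⟨ ℕ.*-monoʳ-< (w t) {{ℕ.>-nonZero (w-pos t)}} et<u ⟩
      w t * u                         ≡⟨ cong (w t *_) (ℕ.m≥n⇒m⊔n≡m (ℕ.<⇒≤ et<u)) ⟨
      w t * (u ⊔ e (toℕ t))           ∎)
      where open ℕ.≤-Reasoning

    F-injective-up-to-reflection : ∀ t s → F (toℕ t) ≡ F (toℕ s) → toℕ t ≡ toℕ s ⊎ toℕ t + toℕ s ≡ m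
    F-injective-up-to-reflection t s Ft≡Fs with ℕ.<-cmp (e (toℕ t)) (e (toℕ s))
    ... | tri< et<es _ _ = ⊥-elim (ℕ.<-irrefl H≡ (H-strict t et<es))
      where H≡ = trans (sym (F+F≡H∘e (Fin.toℕ≤pred[n] t))) (trans (cong₂ _+_ Ft≡Fs Ft≡Fs) (F+F≡H∘e (Fin.toℕ≤pred[n] s)))
    ... | tri> _ _ es<et = ⊥-elim (ℕ.<-irrefl H≡ (H-strict s es<et))
      where H≡ = trans (sym (F+F≡H∘e (Fin.toℕ≤pred[n] s))) (trans (cong₂ _+_ (sym Ft≡Fs) (sym Ft≡Fs)) (F+F≡H∘e (Fin.toℕ≤pred[n] t)))
    ... | tri≈ _ et≡es _ with ∣m-n∣≡∣m-o∣⇒n≡o⊎n+o≡m+m {m} et≡es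
    ...   | inj₁ 2t≡2s   = inj₁ (m+m≡n+n⇒m≡n 2t≡2s)
    ...   | inj₂ 2t+2s≡2m = inj₂ (m+m≡n+n⇒m≡n (trans (solve 2 (λ t s → (t :+ s) :+ (t :+ s) := (t :+ t) :+ (s :+ s)) refl (toℕ t) (toℕ s)) 2t+2s≡2m))

-- Distances, strings and values in finite graphs

module _ (G : FinGraph) where
  open FinGraph G

  record IsPathDistance (d : V → V → ℕ) : Set where
    field
      d-refl : ∀ u → d u u ≡ 0
      d-zero : ∀ {u v} → d u v ≡ 0 → u ≡ v
      d-edge : ∀ u {w v} → T (adj w v) → d u v ≤ suc (d u w)
      d-pred : ∀ u v k → d u v ≡ suc k → Σ V λ w → T (adj w v) × d u w ≡ k

  least≡threshold : ∀ fuel (p : ℕ → Bool) t → (∀ k → T (p k) → t ≤ k) → (∀ k → t ≤ k → T (p k)) →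
                    t < fuel → least G fuel p ≡ t
  least≡threshold (suc fuel) p zero    _      p-from _ with p 0 | p-from 0 z≤n
  ... | true | _ = refl
  least≡threshold (suc fuel) p (suc t) p⇒t≤ p-from (s≤s t<fuel) with p 0 in p0
  ... | true  = ⊥-elim (ℕ.≤⇒≯ (p⇒t≤ 0 (subst T (sym p0) _)) (s≤s z≤n))
  ... | false = cong suc (least≡threshold fuel (p ∘ suc) t (λ k → ℕ.s≤s⁻¹ ∘ p⇒t≤ (suc k)) (λ k → p-from (suc k) ∘ s≤s) t<fuel)

  dist≤diam : ∀ {u v} → u ∈ verts → v ∈ verts → dist G u v ≤ diam G
  dist≤diam = go verts
    where
    go : ∀ xs {u v} → u ∈ xs → v ∈ verts →
         dist G u v ≤ foldr (λ u acc → foldr (λ v → dist G u v ⊔_) acc verts) 0 xs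
    go (x ∷ xs) (here refl) v∈ = ∈⇒≤foldr-⊔ (dist G x) _ verts v∈
    go (x ∷ xs) (there u∈)  v∈ = ℕ.≤-trans (go xs u∈ v∈) (seed≤foldr-⊔ (dist G x) _ verts)

  module _ {d : V → V → ℕ} (isPathDistance : IsPathDistance d) (complete : ∀ v → v ∈ verts) where
    open IsPathDistance isPathDistance

    reach⇒d≤ : ∀ k u v → T (reach G k u v) → d u v ≤ k
    reach⇒d≤ zero u v r with refl ← toWitness r = ℕ.≤-reflexive (d-refl u)
    reach⇒d≤ (suc k) u v r with Equivalence.to T-∨ r
    ... | inj₁ r′ = ℕ.m≤n⇒m≤1+n (reach⇒d≤ k u v r′)
    ... | inj₂ r′ with satisfied (any⁻ _ verts r′)
    ...   | w , rw with Equivalence.to T-∧ rw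
    ...     | r″ , w~v = ℕ.≤-trans (d-edge u w~v) (s≤s (reach⇒d≤ k u w r″))

    d≤⇒reach : ∀ k u v → d u v ≤ k → T (reach G k u v)
    d≤⇒reach zero u v d≤0 = fromWitness (d-zero (ℕ.n≤0⇒n≡0 d≤0))
    d≤⇒reach (suc k) u v d≤ with ℕ.m≤n⇒m<n∨m≡n d≤
    ... | inj₁ (s≤s d≤k) = Equivalence.from T-∨ (inj₁ (d≤⇒reach k u v d≤k))
    ... | inj₂ d≡ with d-pred u v k d≡
    ...   | w , w~v , dw = Equivalence.from T-∨ (inj₂ (any⁺ _ (lose (complete w)
                             (Equivalence.from T-∧ (d≤⇒reach k u w (ℕ.≤-reflexive dw) , w~v)))))

    dist≡pathDistance : ∀ u v → d u v < length verts → dist G u v ≡ d u v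
    dist≡pathDistance u v = least≡threshold (length verts) (λ k → reach G k u v) (d u v) (λ k → reach⇒d≤ k u v) (λ k → d≤⇒reach k u v)

  length≤numValues : ∀ f {xs} → Unique xs → (∀ {x} → x ∈ xs → x ∈ map f verts) → length xs ≤ numValues G f
  length≤numValues f u xs⊆ = Unique⇒length≤ u (∈-deduplicate⁺ ℚ._≟_ ∘ xs⊆)

  numValues≡length : ∀ f {xs} → Unique xs → (∀ {x} → x ∈ xs → x ∈ map f verts) → (∀ v → f v ∈ xs) →
                     numValues G f ≡ length xs
  numValues≡length f {xs} u xs⊆ f∈ = ℕ.≤-antisym
    (Unique⇒length≤ (deduplicate-! ℚ._≟_ (map f verts)) values⊆xs)
    (length≤numValues f u xs⊆)
    where
    values⊆xs : ∀ {x} → x ∈ deduplicate ℚ._≟_ (map f verts) → x ∈ xs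
    values⊆xs x∈ with _ , _ , refl ← ∈-map⁻ f (∈-deduplicate⁻ ℚ._≟_ (map f verts) x∈) = f∈ _

  ¬2≤numValues⇒constant : ∀ f → (∀ v → v ∈ verts) → ¬ 2 ≤ numValues G f → ∀ u w → f u ≡ f w
  ¬2≤numValues⇒constant f complete ¬2≤ u w = decidable-stable (f u ℚ.≟ f w) λ fu≢fw →
    ¬2≤ (length≤numValues f ((fu≢fw All.∷ All.[]) ∷ (All.[] ∷ [])) λ where
      (here refl)         → ∈-map⁺ f (complete u)
      (there (here refl)) → ∈-map⁺ f (complete w))

  string-≡⇒coord-≡ : ∀ f u v → string G f u ≡ string G f v → ∀ i → i < diam G → coord G f u (suc i) ≡ coord G f v (suc i)
  string-≡⇒coord-≡ f u v = go (diam G) (λ i → i)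
    where
    go : ∀ k (h : ℕ → ℕ) → map (λ i → coord G f u (suc i)) (applyUpTo h k) ≡ map (λ i → coord G f v (suc i)) (applyUpTo h k) →
         ∀ i → i < k → coord G f u (suc (h i)) ≡ coord G f v (suc (h i))
    go (suc k) h eq zero    _         = List.∷-injectiveˡ eq
    go (suc k) h eq (suc i) (s≤s i<k) = go k (h ∘ suc) (List.∷-injectiveʳ eq) i i<k

-- Distances in a caterpillar

module Caterpillar (n : ℕ) (L : Fin n → ℕ) where

  G : FinGraph
  G = caterpillar n L

  open FinGraph G public using (V; _≟V_; adj; verts)
  open ℕSum using (sum; ∑-distrib-+; sum-const; listSum-catVerts; catSum; catSum-distrib; catSum-single; catSum-mono)

  spineOf : V → Fin n
  spineOf (inj₁ i)       = i
  spineOf (inj₂ (i , _)) = i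

  pos : V → ℕ
  pos = toℕ ∘ spineOf

  depth : V → ℕ
  depth (inj₁ _) = 0
  depth (inj₂ _) = 1

  -- The distance between distinct vertices; at u = v a leaf it would give 2.
  δ′ : V → V → ℕ
  δ′ u v = ∣ pos u - pos v ∣ + (depth u + depth v)

  δ : V → V → ℕ
  δ u v = if ⌊ u ≟V v ⌋ then 0 else δ′ u v

  δ-refl : ∀ u → δ u u ≡ 0
  δ-refl u with u ≟V u
  ... | yes _   = refl
  ... | no  u≢u = ⊥-elim (u≢u refl)

  δ-≢ : ∀ {u v} → ¬ u ≡ v → δ u v ≡ δ′ u v
  δ-≢ {u} {v} u≢v with u ≟V v
  ... | yes u≡v = ⊥-elim (u≢v u≡v)
  ... | no  _   = refl

  δ′≡0⇒≡ : ∀ u v → δ′ u v ≡ 0 → u ≡ v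
  δ′≡0⇒≡ (inj₁ i) (inj₁ j) δ′≡0 = cong inj₁ (Fin.toℕ-injective (ℕ.∣m-n∣≡0⇒m≡n (trans (sym (ℕ.+-identityʳ _)) δ′≡0)))
  δ′≡0⇒≡ (inj₁ i) (inj₂ _) δ′≡0 = ⊥-elim (ℕ.1+n≢0 (trans (sym (ℕ.+-suc _ 0)) δ′≡0))
  δ′≡0⇒≡ (inj₂ _) v        δ′≡0 = ⊥-elim (ℕ.1+n≢0 (trans (sym (ℕ.+-suc _ _)) δ′≡0))

  δ-from-spine : ∀ t w → δ (inj₁ t) w ≡ ∣ toℕ t - pos w ∣ + depth w
  δ-from-spine t w with inj₁ t ≟V w
  ... | yes refl = sym (cong (_+ 0) (ℕ.∣n-n∣≡0 (toℕ t)))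
  ... | no  _    = refl

  δ≡0⇒≡ : ∀ {u v} → δ u v ≡ 0 → u ≡ v
  δ≡0⇒≡ {u} {v} δ≡0 with u ≟V v
  ... | yes u≡v = u≡v
  ... | no  _   = δ′≡0⇒≡ u v δ≡0

  spine-adj : ∀ {i j} → suc (toℕ i) ≡ toℕ j → T (adj (inj₁ i) (inj₁ j))
  spine-adj eq = Equivalence.from T-∨ (inj₁ (ℕ.≡⇒≡ᵇ _ _ eq))

  spine-adj′ : ∀ {i j} → suc (toℕ j) ≡ toℕ i → T (adj (inj₁ i) (inj₁ j))
  spine-adj′ eq = Equivalence.from T-∨ (inj₂ (ℕ.≡⇒≡ᵇ _ _ eq))

  leaf-adj : ∀ i b → T (adj (inj₂ (i , b)) (inj₁ i))
  leaf-adj i b = fromWitness {a? = i Fin.≟ i} refl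

  leaf-adj′ : ∀ i b → T (adj (inj₁ i) (inj₂ (i , b)))
  leaf-adj′ i b = fromWitness {a? = i Fin.≟ i} refl

  adj⇒δ′≡1 : ∀ w v → T (adj w v) → δ′ w v ≡ 1
  adj⇒δ′≡1 (inj₁ i) (inj₁ j) w~v with Equivalence.to T-∨ w~v
  ... | inj₁ i+1≡j rewrite sym (ℕ.≡ᵇ⇒≡ (suc (toℕ i)) (toℕ j) i+1≡j) =
    cong (_+ 0) (trans (∣m-1+n∣≡1+∣m-n∣ (ℕ.≤-refl {toℕ i})) (cong suc (ℕ.∣n-n∣≡0 (toℕ i))))
  ... | inj₂ j+1≡i rewrite sym (ℕ.≡ᵇ⇒≡ (suc (toℕ j)) (toℕ i) j+1≡i) =
    cong (_+ 0) (trans (∣1+m-n∣≡1+∣m-n∣ (ℕ.≤-refl {toℕ j})) (cong suc (ℕ.∣n-n∣≡0 (toℕ j))))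
  adj⇒δ′≡1 (inj₁ i) (inj₂ (j , _)) w~v with refl ← toWitness w~v = cong (_+ 1) (ℕ.∣n-n∣≡0 (toℕ i))
  adj⇒δ′≡1 (inj₂ (i , _)) (inj₁ j) w~v with refl ← toWitness w~v = cong (_+ 1) (ℕ.∣n-n∣≡0 (toℕ i))

  adj⇒≢ : ∀ w v → T (adj w v) → ¬ w ≡ v
  adj⇒≢ (inj₁ i) _ w~v refl = ℕ.0≢1+n (trans (sym (cong (_+ 0) (ℕ.∣n-n∣≡0 (toℕ i)))) (adj⇒δ′≡1 (inj₁ i) (inj₁ i) w~v))

  adj⇒δ≡1 : ∀ w v → T (adj w v) → δ w v ≡ 1
  adj⇒δ≡1 w v w~v = trans (δ-≢ (adj⇒≢ w v w~v)) (adj⇒δ′≡1 w v w~v)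

  δ-leaf-spine : ∀ i b → δ (inj₂ (i , b)) (inj₁ i) ≡ 1
  δ-leaf-spine i b = adj⇒δ≡1 (inj₂ (i , b)) (inj₁ i) (leaf-adj i b)

  δ-spine-leaf : ∀ i b → δ (inj₁ i) (inj₂ (i , b)) ≡ 1
  δ-spine-leaf i b = adj⇒δ≡1 (inj₁ i) (inj₂ (i , b)) (leaf-adj′ i b)

  δ′-triangle : ∀ u w v → δ′ u v ≤ δ′ u w + δ′ w v
  δ′-triangle u w v = begin
    ∣ pu - pv ∣ + (du + dv)                              ≤⟨ ℕ.+-monoˡ-≤ (du + dv) (ℕ.∣-∣-triangle pu pw pv) ⟩
    (∣ pu - pw ∣ + ∣ pw - pv ∣) + (du + dv)              ≤⟨ ℕ.m≤m+n _ (dw + dw) ⟩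
    (∣ pu - pw ∣ + ∣ pw - pv ∣) + (du + dv) + (dw + dw)  ≡⟨ regroup ∣ pu - pw ∣ ∣ pw - pv ∣ du dv dw ⟩
    δ′ u w + δ′ w v                                      ∎
    where
    open ℕ.≤-Reasoning
    pu = pos u ; pv = pos v ; pw = pos w
    du = depth u ; dv = depth v ; dw = depth w
    regroup = solve 5 (λ a b du dv dw → (a :+ b) :+ (du :+ dv) :+ (dw :+ dw) := (a :+ (du :+ dw)) :+ (b :+ (dw :+ dv))) refl

  δ-edge : ∀ u {w v} → T (adj w v) → δ u v ≤ suc (δ u w)
  δ-edge u {w} {v} w~v with u ≟V v | u ≟V w
  ... | yes _ | _        = z≤n
  ... | no _  | yes refl = ℕ.≤-reflexive (adj⇒δ′≡1 w v w~v)
  ... | no _  | no _     = ℕ.≤-trans (δ′-triangle u w v) (ℕ.≤-reflexive (trans (cong (δ′ u w +_) (adj⇒δ′≡1 w v w~v)) (ℕ.+-comm _ 1)))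

  pos<n : ∀ u → pos u < n
  pos<n u = Fin.toℕ<n (spineOf u)

  δ≤δ′ : ∀ u v → δ u v ≤ δ′ u v
  δ≤δ′ u v with u ≟V v
  ... | yes _ = z≤n
  ... | no  _ = ℕ.≤-refl

  pos-gap<n : ∀ u v → ∣ pos u - pos v ∣ < n
  pos-gap<n u v = ℕ.≤-<-trans (ℕ.∣m-n∣≤m⊔n (pos u) (pos v)) (ℕ.⊔-lub (pos<n u) (pos<n v))

  δ≤1+n : ∀ u v → δ u v ≤ suc n
  δ≤1+n u v = ℕ.≤-trans (δ≤δ′ u v)
    (ℕ.s≤s⁻¹ (ℕ.≤-trans (ℕ.+-mono-<-≤ (pos-gap<n u v) (ℕ.+-mono-≤ (depth≤1 u) (depth≤1 v))) (ℕ.≤-reflexive (ℕ.+-comm n 2))))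
    where
    depth≤1 : ∀ w → depth w ≤ 1
    depth≤1 (inj₁ _) = z≤n
    depth≤1 (inj₂ _) = s≤s z≤n

  Predecessor : V → V → ℕ → Set
  Predecessor u v k = Σ V λ w → T (adj w v) × δ u w ≡ k

  predecessor-via : ∀ u {v k} w → T (adj w v) → δ′ u v ≡ suc k → (¬ u ≡ w → δ′ u w ≡ k) → Predecessor u v k
  predecessor-via u {v} w w~v δ′≡ δ′w≡ with u ≟V w
  ... | yes refl = w , w~v , trans (δ-refl u) (ℕ.suc-injective (trans (sym (adj⇒δ′≡1 w v w~v)) δ′≡))
  ... | no u≢w   = w , w~v , trans (δ-≢ u≢w) (δ′w≡ u≢w)

  δ′-leaf : ∀ u j b → δ′ u (inj₂ (j , b)) ≡ suc (δ′ u (inj₁ j))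
  δ′-leaf u j b = trans (cong (∣ pos u - toℕ j ∣ +_) (ℕ.+-suc (depth u) 0)) (ℕ.+-suc _ _)

  predecessor-same : ∀ u {j k} → pos u ≡ toℕ j → ¬ u ≡ inj₁ j → δ′ u (inj₁ j) ≡ suc k → Predecessor u (inj₁ j) k
  predecessor-same (inj₁ i)       pu≡j u≢v _ = ⊥-elim (u≢v (cong inj₁ (Fin.toℕ-injective pu≡j)))
  predecessor-same (inj₂ (i , a)) pu≡j _ δ′≡ with refl ← Fin.toℕ-injective pu≡j =
    predecessor-via (inj₂ (i , a)) (inj₂ (i , a)) (leaf-adj i a) δ′≡ (λ u≢u → ⊥-elim (u≢u refl))

  predecessor-below : ∀ u {j k} → pos u < toℕ j → δ′ u (inj₁ j) ≡ suc k → Predecessor u (inj₁ j) k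
  predecessor-below u {suc j} (s≤s pu≤j) δ′≡ =
    predecessor-via u (inj₁ (Fin.inject₁ j)) (spine-adj (cong suc (Fin.toℕ-inject₁ j))) δ′≡ λ _ → ℕ.suc-injective (trans step δ′≡)
    where
    step : suc (δ′ u (inj₁ (Fin.inject₁ j))) ≡ δ′ u (inj₁ (suc j))
    step = trans (cong (λ x → suc (∣ pos u - x ∣ + (depth u + 0))) (Fin.toℕ-inject₁ j))
                 (cong (_+ (depth u + 0)) (sym (∣m-1+n∣≡1+∣m-n∣ pu≤j)))

  predecessor-above : ∀ u {j k} → toℕ j < pos u → δ′ u (inj₁ j) ≡ suc k → Predecessor u (inj₁ j) k
  predecessor-above u {j} j<pu δ′≡ =
    predecessor-via u (inj₁ j⁺) (spine-adj′ (sym (Fin.toℕ-fromℕ< j+1<n))) δ′≡ λ _ → ℕ.suc-injective (trans step δ′≡)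
    where
    j+1<n = ℕ.<-≤-trans (s≤s j<pu) (pos<n u)
    j⁺ = Fin.fromℕ< j+1<n
    step : suc (δ′ u (inj₁ j⁺)) ≡ δ′ u (inj₁ j)
    step = trans (cong (λ x → suc (∣ pos u - x ∣ + (depth u + 0))) (Fin.toℕ-fromℕ< j+1<n))
                 (cong (_+ (depth u + 0)) (sym (∣m-n∣≡1+∣m-1+n∣ j<pu)))

  predecessor : ∀ u v k → δ u v ≡ suc k → Predecessor u v k
  predecessor u v k δ≡ with u ≟V v
  predecessor u (inj₂ (j , b)) k δ′≡ | no _ =
    predecessor-via u (inj₁ j) (leaf-adj′ j b) δ′≡ λ _ → ℕ.suc-injective (trans (sym (δ′-leaf u j b)) δ′≡)
  predecessor u (inj₁ j) k δ′≡ | no u≢v with ℕ.<-cmp (pos u) (toℕ j)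
  ... | tri< pu<j _ _ = predecessor-below u pu<j δ′≡
  ... | tri≈ _ pu≡j _ = predecessor-same u pu≡j u≢v δ′≡
  ... | tri> _ _ j<pu = predecessor-above u j<pu δ′≡

  isPathDistance : IsPathDistance G δ
  isPathDistance = record { d-refl = δ-refl ; d-zero = δ≡0⇒≡ ; d-edge = δ-edge ; d-pred = predecessor }

  ∈-verts : ∀ v → v ∈ verts
  ∈-verts (inj₁ i)       = ∈-++⁺ˡ (∈-map⁺ inj₁ (∈-allFin i))
  ∈-verts (inj₂ (i , j)) = ∈-++⁺ʳ (map inj₁ (allFin n))
    (∈-concat⁺′ (∈-map⁺ (λ j → inj₂ (i , j)) (∈-allFin j)) (∈-map⁺ (λ i → map (λ j → inj₂ (i , j)) (allFin (L i))) (∈-allFin i)))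

  indicator : V → (V → ℕ) → V → ℕ
  indicator v F w = if ⌊ w ≟V v ⌋ then F w else 0

  catSum-indicator : ∀ v F → catSum n L (indicator v F) ≡ F v
  catSum-indicator v F = trans (catSum-single (indicator v F) v off-v) at-v
    where
    off-v : ∀ w → ¬ w ≡ v → indicator v F w ≡ 0
    off-v w w≢v with w ≟V v
    ... | yes w≡v = ⊥-elim (w≢v w≡v)
    ... | no  _   = refl
    at-v : indicator v F v ≡ F v
    at-v with v ≟V v
    ... | yes _   = refl
    ... | no  v≢v = ⊥-elim (v≢v refl)

  catSum-≥-pair : ∀ F {a b} → ¬ a ≡ b → F a + F b ≤ catSum n L F
  catSum-≥-pair F {a} {b} a≢b = begin
    F a + F b                                                  ≡⟨ cong₂ _+_ (catSum-indicator a F) (catSum-indicator b F) ⟨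
    catSum n L (indicator a F) + catSum n L (indicator b F)    ≡⟨ catSum-distrib (indicator a F) (indicator b F) ⟨
    catSum n L (λ w → indicator a F w + indicator b F w)       ≤⟨ catSum-mono pointwise ⟩
    catSum n L F                                               ∎
    where
    open ℕ.≤-Reasoning
    pointwise : ∀ w → indicator a F w + indicator b F w ≤ F w
    pointwise w with w ≟V a | w ≟V b
    ... | yes refl | yes refl = ⊥-elim (a≢b refl)
    ... | yes _    | no _     = ℕ.≤-reflexive (ℕ.+-identityʳ _)
    ... | no _     | yes _    = ℕ.≤-refl
    ... | no _     | no _     = z≤n

  length-verts : length verts ≡ n + catSum n L depth
  length-verts = begin
    length verts                                       ≡⟨ listSum-catVerts {n} {L} (λ _ → 1) ⟩
    catSum n L (λ _ → 1)                               ≡⟨ ∑-distrib-+ {n} (λ _ → 1) (λ i → sum {L i} (λ _ → 1)) ⟩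
    sum {n} (λ _ → 1) + catSum n L depth               ≡⟨ cong (_+ catSum n L depth) (trans (sum-const n 1) (ℕ.*-identityʳ n)) ⟩
    n + catSum n L depth                               ∎
    where open ≡-Reasoning

  δ<length : ∀ u v → δ u v < length verts
  δ<length u v with u ≟V v
  ... | yes _   = ℕ.<-≤-trans (ℕ.≤-<-trans z≤n (pos<n u)) (ℕ.≤-trans (ℕ.m≤m+n n _) (ℕ.≤-reflexive (sym length-verts)))
  ... | no  u≢v = ℕ.<-≤-trans (ℕ.+-mono-<-≤ (pos-gap<n u v) (catSum-≥-pair depth u≢v)) (ℕ.≤-reflexive (sym length-verts))

  dist≡δ : ∀ u v → dist G u v ≡ δ u v
  dist≡δ u v = dist≡pathDistance G isPathDistance ∈-verts u v (δ<length u v)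

  δ≤diam : ∀ u v → δ u v ≤ diam G
  δ≤diam u v = subst (_≤ diam G) (dist≡δ u v) (dist≤diam G (∈-verts u) (∈-verts v))

  coord≡catSum : ∀ f v i → coord G f v i ≡ ℚSum.catSum n L (λ w → if δ v w ≡ᵇ i then f w else 0ℚ)
  coord≡catSum f v i = begin
    coord G f v i
      ≡⟨ ℚSum.foldr-if≡listSum verts (λ w → dist G v w ≡ᵇ i) f ⟩
    ℚSum.listSum verts (λ w → if dist G v w ≡ᵇ i then f w else 0ℚ)
      ≡⟨ ℚSum.listSum-catVerts (λ w → if dist G v w ≡ᵇ i then f w else 0ℚ) ⟩
    ℚSum.catSum n L (λ w → if dist G v w ≡ᵇ i then f w else 0ℚ)
      ≡⟨ ℚSum.catSum-cong (λ w → cong (λ d → if d ≡ᵇ i then f w else 0ℚ) (dist≡δ v w)) ⟩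
    ℚSum.catSum n L (λ w → if δ v w ≡ᵇ i then f w else 0ℚ) ∎
    where open ≡-Reasoning

  TwoNeighbours : Fin n → Set
  TwoNeighbours t = Σ V λ w₁ → Σ V λ w₂ → ¬ w₁ ≡ w₂ × δ (inj₁ t) w₁ ≡ 1 × δ (inj₁ t) w₂ ≡ 1

  leaf-neighbour : ∀ t b w → δ (inj₂ (t , b)) w ≡ 1 → w ≡ inj₁ t
  leaf-neighbour t b w δ≡1 with inj₂ (t , b) ≟V w
  leaf-neighbour t b (inj₁ i)       δ′≡1 | no _ = cong inj₁ (sym (Fin.toℕ-injective (ℕ.∣m-n∣≡0⇒m≡n (ℕ.+-cancelʳ-≡ 1 _ 0 δ′≡1))))
  leaf-neighbour t b (inj₂ (i , a)) δ′≡1 | no _ = case subst (2 ≤_) δ′≡1 (ℕ.m≤n+m 2 ∣ toℕ t - toℕ i ∣) of λ { (s≤s ()) }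

-- Symmetries and the lower bound

⟨$⟩ʳ-injective : ∀ {m k} (π : Permutation m k) {i j} → π ⟨$⟩ʳ i ≡ π ⟨$⟩ʳ j → i ≡ j
⟨$⟩ʳ-injective π {i} {j} eq = trans (sym (Perm.inverseˡ π)) (trans (cong (π ⟨$⟩ˡ_) eq) (Perm.inverseˡ π))

transpose-matchˡ : ∀ {k} (a b : Fin k) → Perm.transpose a b ⟨$⟩ʳ a ≡ b
transpose-matchˡ a b with a Fin.≟ a
... | yes _   = refl
... | no  a≢a = ⊥-elim (a≢a refl)

transpose-preserves : ∀ {k} {X : Set} (g : Fin k → X) {a b} → g a ≡ g b → ∀ j → g (Perm.transpose a b ⟨$⟩ʳ j) ≡ g j
transpose-preserves g {a} {b} ga≡gb j with j Fin.≟ a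
... | yes refl = sym ga≡gb
... | no _ with j Fin.≟ b
...   | yes refl = ga≡gb
...   | no _     = refl

module CaterpillarSymmetry (n : ℕ) (L : Fin n → ℕ) where
  open Caterpillar n L

  -- Invariance of catSum is how we use that σ permutes the vertices.
  record Symmetry : Set where
    field
      σ        : V → V
      σ-δ      : ∀ u w → δ (σ u) (σ w) ≡ δ u w
      σ-catSum : ∀ H → ℚSum.catSum n L (H ∘ σ) ≡ ℚSum.catSum n L H

  module _ (S : Symmetry) (f : V → ℚ) (f∘σ≗f : ∀ w → f (Symmetry.σ S w) ≡ f w) where
    open Symmetry S

    string-σ : ∀ v → string G f (σ v) ≡ string G f v
    string-σ v = List.map-cong (λ i → coord-σ (suc i)) (upTo (diam G))
      where
      coord-σ : ∀ i → coord G f (σ v) i ≡ coord G f v i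
      coord-σ i = begin
        coord G f (σ v) i                                                    ≡⟨ coord≡catSum f (σ v) i ⟩
        ℚSum.catSum n L (λ w → if δ (σ v) w ≡ᵇ i then f w else 0ℚ)          ≡⟨ σ-catSum (λ w → if δ (σ v) w ≡ᵇ i then f w else 0ℚ) ⟨
        ℚSum.catSum n L (λ w → if δ (σ v) (σ w) ≡ᵇ i then f (σ w) else 0ℚ)
          ≡⟨ ℚSum.catSum-cong (λ w → cong₂ (λ d x → if d ≡ᵇ i then x else 0ℚ) (σ-δ v w) (f∘σ≗f w)) ⟩
        ℚSum.catSum n L (λ w → if δ v w ≡ᵇ i then f w else 0ℚ)              ≡⟨ coord≡catSum f v i ⟨
        coord G f v i                                                        ∎
        where open ≡-Reasoning

    Distinguishing⇒σ-fixes : Distinguishing G f → ∀ v → σ v ≡ v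
    Distinguishing⇒σ-fixes distinguishing v = distinguishing (σ v) v (string-σ v)

  module Relabelling (π : Permutation′ n) (ρ : ∀ i → Permutation (L i) (L (π ⟨$⟩ʳ i)))
                     (π-isometry : ∀ i j → ∣ toℕ (π ⟨$⟩ʳ i) - toℕ (π ⟨$⟩ʳ j) ∣ ≡ ∣ toℕ i - toℕ j ∣) where

    relabel : V → V
    relabel (inj₁ i)       = inj₁ (π ⟨$⟩ʳ i)
    relabel (inj₂ (i , j)) = inj₂ (π ⟨$⟩ʳ i , ρ i ⟨$⟩ʳ j)

    spineOf-relabel : ∀ u → spineOf (relabel u) ≡ π ⟨$⟩ʳ spineOf u
    spineOf-relabel (inj₁ _) = refl
    spineOf-relabel (inj₂ _) = refl

    depth-relabel : ∀ u → depth (relabel u) ≡ depth u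
    depth-relabel (inj₁ _) = refl
    depth-relabel (inj₂ _) = refl

    relabel-injective : ∀ u w → relabel u ≡ relabel w → u ≡ w
    relabel-injective (inj₁ i)       (inj₁ j)       eq = cong inj₁ (⟨$⟩ʳ-injective π (inj₁-injective eq))
    relabel-injective (inj₂ (i , a)) (inj₂ (j , b)) eq with refl ← ⟨$⟩ʳ-injective π (cong proj₁ (inj₂-injective eq)) =
      cong (λ x → inj₂ (i , x)) (⟨$⟩ʳ-injective (ρ i) (leaf-injective eq))

    relabel-δ : ∀ u w → δ (relabel u) (relabel w) ≡ δ u w
    relabel-δ u w with u ≟V w
    ... | yes refl = δ-refl (relabel u)
    ... | no  u≢w  = trans (δ-≢ (u≢w ∘ relabel-injective u w)) (cong₂ _+_ pos-gap (cong₂ _+_ (depth-relabel u) (depth-relabel w)))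
      where
      pos-gap : ∣ pos (relabel u) - pos (relabel w) ∣ ≡ ∣ pos u - pos w ∣
      pos-gap = trans (cong₂ (λ i j → ∣ toℕ i - toℕ j ∣) (spineOf-relabel u) (spineOf-relabel w)) (π-isometry _ _)

    relabel-catSum : ∀ H → ℚSum.catSum n L (H ∘ relabel) ≡ ℚSum.catSum n L H
    relabel-catSum H = begin
      ℚSum.sum (λ i → H (inj₁ (π ⟨$⟩ʳ i)) ℚ.+ ℚSum.sum (λ j → H (inj₂ (π ⟨$⟩ʳ i , ρ i ⟨$⟩ʳ j))))
        ≡⟨ ℚSum.sum-cong-≗ (λ i → cong (H (inj₁ (π ⟨$⟩ʳ i)) ℚ.+_) (ℚSum.∑-permute (λ j → H (inj₂ (π ⟨$⟩ʳ i , j))) (ρ i))) ⟨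
      ℚSum.sum (λ i → H-at (π ⟨$⟩ʳ i))
        ≡⟨ ℚSum.∑-permute H-at π ⟨
      ℚSum.sum H-at ∎
      where
      open ≡-Reasoning
      H-at : Fin n → ℚ
      H-at k = H (inj₁ k) ℚ.+ ℚSum.sum (λ j → H (inj₂ (k , j)))

    symmetry : Symmetry
    symmetry = record { σ = relabel ; σ-δ = relabel-δ ; σ-catSum = relabel-catSum }

  transposeAt : ∀ t (a b : Fin (L t)) i → Dec (i ≡ t) → Permutation′ (L i)
  transposeAt t a b i (yes refl) = Perm.transpose a b
  transposeAt t a b i (no _)     = Perm.id

  module LeafSwap (t : Fin n) (a b : Fin (L t)) where
    open Relabelling Perm.id (λ i → transposeAt t a b i (i Fin.≟ t)) (λ _ _ → refl) public

    relabel-a : relabel (inj₂ (t , a)) ≡ inj₂ (t , b)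
    relabel-a = cong (λ x → inj₂ (t , x)) (swap-a (t Fin.≟ t))
      where
      swap-a : (d : Dec (t ≡ t)) → transposeAt t a b t d ⟨$⟩ʳ a ≡ b
      swap-a (yes refl) = transpose-matchˡ a b
      swap-a (no t≢t)   = ⊥-elim (t≢t refl)

    relabel-preserves : ∀ (f : V → ℚ) → f (inj₂ (t , a)) ≡ f (inj₂ (t , b)) → ∀ w → f (relabel w) ≡ f w
    relabel-preserves f fa≡fb (inj₁ i)       = refl
    relabel-preserves f fa≡fb (inj₂ (i , j)) = at i (i Fin.≟ t) j
      where
      at : ∀ i (d : Dec (i ≡ t)) j → f (inj₂ (i , transposeAt t a b i d ⟨$⟩ʳ j)) ≡ f (inj₂ (i , j))
      at i (yes refl) j = transpose-preserves (λ x → f (inj₂ (i , x))) fa≡fb j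
      at i (no _)     j = refl

  Distinguishing⇒leaf-values-injective : ∀ f → Distinguishing G f → ∀ t {a b} → f (inj₂ (t , a)) ≡ f (inj₂ (t , b)) → a ≡ b
  Distinguishing⇒leaf-values-injective f distinguishing t {a} {b} fa≡fb =
    sym (leaf-injective (trans (sym relabel-a) (Distinguishing⇒σ-fixes symmetry f (relabel-preserves f fa≡fb) distinguishing (inj₂ (t , a)))))
    where open LeafSwap t a b

  Distinguishing⇒L≤numValues : ∀ f → Distinguishing G f → ∀ t → L t ≤ numValues G f
  Distinguishing⇒L≤numValues f distinguishing t = subst (_≤ numValues G f) length-leafValues
    (length≤numValues G f (Unique.map⁺ (Distinguishing⇒leaf-values-injective f distinguishing t) (Unique.allFin⁺ (L t)))
                     (λ x∈ → case ∈-map⁻ leafValue x∈ of λ { (j , _ , refl) → ∈-map⁺ f (∈-verts (inj₂ (t , j))) }))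
    where
    leafValue : Fin (L t) → ℚ
    leafValue j = f (inj₂ (t , j))
    length-leafValues : length (map leafValue (allFin (L t))) ≡ L t
    length-leafValues = trans (List.length-map leafValue (allFin (L t))) (List.length-tabulate (λ j → j))

module Reflection (m : ℕ) (L : Fin (suc m) → ℕ) (L-sym : ∀ j → L j ≡ L (opposite j)) where
  open Caterpillar (suc m) L
  open CaterpillarSymmetry (suc m) L

  opposite-isometry : ∀ (i j : Fin (suc m)) → ∣ toℕ (opposite i) - toℕ (opposite j) ∣ ≡ ∣ toℕ i - toℕ j ∣
  opposite-isometry i j = trans (cong₂ ∣_-_∣ (Fin.opposite-prop i) (Fin.opposite-prop j))
                                (∣m∸n-m∸o∣≡∣n-o∣ (Fin.toℕ≤pred[n] i) (Fin.toℕ≤pred[n] j))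

  reflection : Permutation′ (suc m)
  reflection = Perm.reverse

  open Relabelling reflection (λ i → Perm.cast-id (L-sym i)) opposite-isometry public

  pos-relabel : ∀ u → pos (relabel u) ≡ m ∸ pos u
  pos-relabel u = trans (cong toℕ (spineOf-relabel u)) (Fin.opposite-prop (spineOf u))

module K₂ (L : Fin 1 → ℕ) (L≡1 : L zero ≡ 1) where
  open Caterpillar 1 L
  open CaterpillarSymmetry 1 L

  leaf₀ : Fin (L zero)
  leaf₀ = subst Fin (sym L≡1) zero

  unique-leaf : ∀ j → j ≡ leaf₀
  unique-leaf j = Fin.toℕ-injective (trans (index≡0 j) (sym (index≡0 leaf₀)))
    where
    index≡0 : ∀ (x : Fin (L zero)) → toℕ x ≡ 0
    index≡0 x = ℕ.n<1⇒n≡0 (subst (toℕ x <_) L≡1 (Fin.toℕ<n x))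

  swap : V → V
  swap (inj₁ zero)        = inj₂ (zero , leaf₀)
  swap (inj₂ (zero , _))  = inj₁ zero

  swap-δ : ∀ u w → δ (swap u) (swap w) ≡ δ u w
  swap-δ (inj₁ zero)       (inj₁ zero)        = trans (δ-refl (inj₂ (zero , leaf₀))) (sym (δ-refl (inj₁ zero)))
  swap-δ (inj₁ zero)       (inj₂ (zero , j))  = trans (δ-leaf-spine zero leaf₀) (sym (δ-spine-leaf zero j))
  swap-δ (inj₂ (zero , j)) (inj₁ zero)        = trans (δ-spine-leaf zero leaf₀) (sym (δ-leaf-spine zero j))
  swap-δ (inj₂ (zero , j)) (inj₂ (zero , j′)) rewrite unique-leaf j | unique-leaf j′ = trans (δ-refl (inj₁ zero)) (sym (δ-refl (inj₂ (zero , leaf₀))))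

  swap-catSum : ∀ H → ℚSum.catSum 1 L (H ∘ swap) ≡ ℚSum.catSum 1 L H
  swap-catSum H = cong (ℚ._+ 0ℚ) (begin
    H ℓ ℚ.+ ℚSum.sum {L zero} (λ _ → H s)             ≡⟨ cong (H ℓ ℚ.+_) (ℚSum.sum-single (λ _ → H s) leaf₀ only-leaf) ⟩
    H ℓ ℚ.+ H s                                       ≡⟨ ℚ.+-comm (H ℓ) (H s) ⟩
    H s ℚ.+ H ℓ                                       ≡⟨ cong (H s ℚ.+_) (ℚSum.sum-single (λ j → H (inj₂ (zero , j))) leaf₀ only-leaf) ⟨
    H s ℚ.+ ℚSum.sum (λ j → H (inj₂ (zero , j)))      ∎)
    where
    open ≡-Reasoning
    s = inj₁ zero
    ℓ = inj₂ (zero , leaf₀)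
    only-leaf : ∀ {F : Fin (L zero) → ℚ} j → ¬ j ≡ leaf₀ → F j ≡ 0ℚ
    only-leaf j j≢ = ⊥-elim (j≢ (unique-leaf j))

  symmetry : Symmetry
  symmetry = record { σ = swap ; σ-δ = swap-δ ; σ-catSum = swap-catSum }

constant⇒¬Distinguishing : ∀ m (L : Fin (suc m) → ℕ) → 1 ≤ L zero → (∀ j → L j ≡ L (opposite j)) →
  ∀ f → (∀ u w → f u ≡ f w) → ¬ Distinguishing (caterpillar (suc m) L) f
constant⇒¬Distinguishing (suc m) L L₀≥1 L-sym f constant distinguishing =
  ℕ.1+n≢0 (trans (sym (pos-relabel v)) (cong pos (Distinguishing⇒σ-fixes symmetry f (λ w → constant _ w) distinguishing v)))
  where
  open Caterpillar (suc (suc m)) L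
  open CaterpillarSymmetry (suc (suc m)) L
  open Reflection (suc m) L L-sym
  v = inj₂ (zero , Fin.fromℕ< L₀≥1)
constant⇒¬Distinguishing zero L L₀≥1 L-sym f constant distinguishing with ℕ.m≤n⇒m<n∨m≡n L₀≥1
... | inj₁ L₀≥2 = ℕ.0≢1+n (trans (sym (Fin.toℕ-fromℕ< L₀≥1)) (trans (cong toℕ first≡second) (Fin.toℕ-fromℕ< L₀≥2)))
  where
  open CaterpillarSymmetry 1 L
  first≡second = Distinguishing⇒leaf-values-injective f distinguishing zero (constant (inj₂ (zero , Fin.fromℕ< L₀≥1)) (inj₂ (zero , Fin.fromℕ< L₀≥2)))
... | inj₂ 1≡L₀ = case Distinguishing⇒σ-fixes symmetry f (λ w → constant _ w) distinguishing (inj₁ zero) of λ ()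
  where
  open CaterpillarSymmetry 1 L
  open K₂ L (sym 1≡L₀)

Distinguishing⇒2≤numValues : ∀ m (L : Fin (suc m) → ℕ) → 1 ≤ L zero → (∀ j → L j ≡ L (opposite j)) →
  ∀ f → Distinguishing (caterpillar (suc m) L) f → 2 ≤ numValues (caterpillar (suc m) L) f
Distinguishing⇒2≤numValues m L L₀≥1 L-sym f distinguishing with 2 ℕ.≤? numValues (caterpillar (suc m) L) f
... | yes 2≤ = 2≤
... | no ¬2≤ = ⊥-elim (constant⇒¬Distinguishing m L L₀≥1 L-sym f
                 (¬2≤numValues⇒constant (caterpillar (suc m) L) f (Caterpillar.∈-verts (suc m) L) ¬2≤) distinguishing)

-- A distinguishing function with max (L, 2) values

two-neighbours : ∀ m (L : Fin (suc m) → ℕ) → 1 ≤ L zero → 1 ≤ L (fromℕ m) →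
                 ∀ t → (m ≡ 0 × L zero ≡ 1) ⊎ Caterpillar.TwoNeighbours (suc m) L t
two-neighbours zero L L₀≥1 _ zero with ℕ.m≤n⇒m<n∨m≡n L₀≥1
... | inj₂ 1≡L₀ = inj₁ (refl , sym 1≡L₀)
... | inj₁ L₀≥2 = inj₂ (inj₂ (zero , leaf₀) , inj₂ (zero , leaf₁) , leaf₀≢leaf₁ , δ-spine-leaf zero leaf₀ , δ-spine-leaf zero leaf₁)
  where
  open Caterpillar 1 L
  leaf₀ = Fin.fromℕ< L₀≥1
  leaf₁ = Fin.fromℕ< L₀≥2
  leaf₀≢leaf₁ : ¬ inj₂ (zero , leaf₀) ≡ inj₂ (zero , leaf₁)
  leaf₀≢leaf₁ eq = ℕ.0≢1+n (trans (sym (Fin.toℕ-fromℕ< L₀≥1)) (trans (cong toℕ (leaf-injective eq)) (Fin.toℕ-fromℕ< L₀≥2)))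
two-neighbours (suc m) L L₀≥1 _ zero = inj₂ (inj₁ (suc zero) , inj₂ (zero , Fin.fromℕ< L₀≥1) , (λ ()) ,
  adj⇒δ≡1 (inj₁ zero) (inj₁ (suc zero)) (spine-adj {zero} {suc zero} refl) , δ-spine-leaf zero (Fin.fromℕ< L₀≥1))
  where open Caterpillar (suc (suc m)) L
two-neighbours (suc m) L _ Lₘ≥1 (suc t) with toℕ (suc t) ℕ.<? suc m
... | yes t+1<m+1 = inj₂ (below , inj₁ above , below≢above , adj⇒δ≡1 (inj₁ (suc t)) below (spine-adj′ {suc t} (cong suc (Fin.toℕ-inject₁ t))) ,
                          adj⇒δ≡1 (inj₁ (suc t)) (inj₁ above) (spine-adj {suc t} (sym (Fin.toℕ-fromℕ< (s≤s t+1<m+1)))))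
  where
  open Caterpillar (suc (suc m)) L
  below = inj₁ (Fin.inject₁ t)
  above = Fin.fromℕ< (s≤s t+1<m+1)
  below≢above : ¬ below ≡ inj₁ above
  below≢above eq = ℕ.<-irrefl (trans (sym (Fin.toℕ-inject₁ t)) (trans (cong (toℕ ∘ spineOf) eq) (Fin.toℕ-fromℕ< (s≤s t+1<m+1))))
                              (ℕ.<-trans (ℕ.n<1+n _) (ℕ.n<1+n _))
... | no t+1≮m+1 = inj₂ (inj₁ (Fin.inject₁ t) , inj₂ (suc t , leaf) , (λ ()) ,
                         adj⇒δ≡1 (inj₁ (suc t)) (inj₁ (Fin.inject₁ t)) (spine-adj′ {suc t} (cong suc (Fin.toℕ-inject₁ t))) , δ-spine-leaf (suc t) leaf)
  where
  open Caterpillar (suc (suc m)) L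
  last : suc t ≡ fromℕ (suc m)
  last = Fin.toℕ-injective (trans (ℕ.≤∧≮⇒≡ (Fin.toℕ≤pred[n] (suc t)) t+1≮m+1) (sym (Fin.toℕ-fromℕ (suc m))))
  leaf : Fin (L (suc t))
  leaf = Fin.fromℕ< (subst (λ k → 1 ≤ L k) (sym last) Lₘ≥1)

module Construction (m : ℕ) (L : Fin (suc m) → ℕ) (L₀≥1 : 1 ≤ L zero) (Lₘ≥1 : 1 ≤ L (fromℕ m))
                    (L-sym : ∀ j → L j ≡ L (opposite j)) where
  open Caterpillar (suc m) L
  open ℕSum using (sum; sum-cong-≗; ∑-distrib-+; sum-single; sum-const; *-distribˡ-sum; weightedSum; weightedSum-cong; weightedSum-indicator;
                   catSum; catSum-cong; catSum-distrib; catSum-single; catSum-∑-comm; catSum-scale; catSum-mono)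

  c : V → ℕ
  c (inj₁ zero)    = 1
  c (inj₁ (suc _)) = 0
  c (inj₂ (_ , j)) = toℕ j

  -- N exceeds every W₁ below, so that W (spine t) = N * W₀ t + W₁ t can be decoded.
  N : ℕ
  N = 2 + (2 + m) * catSum (suc m) L c

  g : V → ℕ
  g w = N + c w

  f : V → ℚ
  f = toℚ ∘ g

  D : ℕ
  D = diam G

  coordℕ : V → ℕ → ℕ
  coordℕ v i = catSum (suc m) L (λ w → if δ v w ≡ᵇ i then g w else 0)

  coord-f≡toℚ : ∀ v i → coord G f v i ≡ toℚ (coordℕ v i)
  coord-f≡toℚ v i = trans (coord≡catSum f v i) (trans (ℚSum.catSum-cong pointwise) (sym (toℚ-catSum (λ w → if δ v w ≡ᵇ i then g w else 0))))
    where
    pointwise : ∀ w → (if δ v w ≡ᵇ i then f w else 0ℚ) ≡ toℚ (if δ v w ≡ᵇ i then g w else 0)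
    pointwise w with δ v w ≡ᵇ i
    ... | true  = refl
    ... | false = refl

  module _ {u v} (same-string : string G f u ≡ string G f v) where

    coordℕ-≡ : ∀ i → i < D → coordℕ u (suc i) ≡ coordℕ v (suc i)
    coordℕ-≡ i i<D = toℚ-injective (trans (sym (coord-f≡toℚ u (suc i))) (trans (string-≡⇒coord-≡ G f u v same-string i i<D) (coord-f≡toℚ v (suc i))))

  moment : (ℕ → ℕ) → V → ℕ
  moment φ v = catSum (suc m) L (λ w → φ (δ v w) * g w)

  moment≡weightedSum : ∀ φ v → moment φ v ≡ weightedSum φ D (coordℕ v)
  moment≡weightedSum φ v = begin
    catSum (suc m) L (λ w → φ (δ v w) * g w)
      ≡⟨ catSum-cong (λ w → weightedSum-indicator φ (g w) (δ≤diam v w)) ⟨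
    catSum (suc m) L (λ w → weightedSum φ D (λ i → if δ v w ≡ᵇ i then g w else 0))
      ≡⟨ catSum-∑-comm {k = suc D} (λ i w → φ (toℕ i) * (if δ v w ≡ᵇ toℕ i then g w else 0)) ⟩
    sum {suc D} (λ i → catSum (suc m) L (λ w → φ (toℕ i) * (if δ v w ≡ᵇ toℕ i then g w else 0)))
      ≡⟨ sum-cong-≗ {suc D} (λ i → catSum-scale (φ (toℕ i)) (λ w → if δ v w ≡ᵇ toℕ i then g w else 0)) ⟩
    weightedSum φ D (coordℕ v) ∎
    where open ≡-Reasoning

  string-≡⇒moment-≡ : ∀ {φ u v} → φ 0 ≡ 0 → string G f u ≡ string G f v → moment φ u ≡ moment φ v
  string-≡⇒moment-≡ {φ} {u} {v} φ0≡0 same-string = begin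
    moment φ u                   ≡⟨ moment≡weightedSum φ u ⟩
    weightedSum φ D (coordℕ u)   ≡⟨ weightedSum-cong φ D {coordℕ u} {coordℕ v} φ0≡0 (coordℕ-≡ {u} {v} same-string) ⟩
    weightedSum φ D (coordℕ v)   ≡⟨ moment≡weightedSum φ v ⟨
    moment φ v                   ∎
    where open ≡-Reasoning

  positive : ℕ → ℕ
  positive zero    = 0
  positive (suc _) = 1

  total : ℕ
  total = catSum (suc m) L g

  moment-positive+g≡total : ∀ v → moment positive v + g v ≡ total
  moment-positive+g≡total v = begin
    moment positive v + g v                                                   ≡⟨ cong (moment positive v +_) (catSum-indicator v g) ⟨
    moment positive v + catSum (suc m) L (indicator v g)                      ≡⟨ catSum-distrib (λ w → positive (δ v w) * g w) (indicator v g) ⟨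
    catSum (suc m) L (λ w → positive (δ v w) * g w + indicator v g w)         ≡⟨ catSum-cong pointwise ⟩
    total                                                                     ∎
    where
    open ≡-Reasoning
    pointwise : ∀ w → positive (δ v w) * g w + indicator v g w ≡ g w
    pointwise w with w ≟V v
    ... | yes refl rewrite δ-refl w = refl
    ... | no w≢v with δ v w in δ≡
    ...   | zero  = ⊥-elim (w≢v (sym (δ≡0⇒≡ δ≡)))
    ...   | suc _ = trans (ℕ.+-identityʳ _) (ℕ.+-identityʳ (g w))

  string-≡⇒g-≡ : ∀ {u v} → string G f u ≡ string G f v → g u ≡ g v
  string-≡⇒g-≡ {u} {v} same-string = ℕ.+-cancelˡ-≡ (moment positive u) (g u) (g v) (begin
    moment positive u + g u   ≡⟨ moment-positive+g≡total u ⟩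
    total                     ≡⟨ moment-positive+g≡total v ⟨
    moment positive v + g v   ≡⟨ cong (_+ g v) (string-≡⇒moment-≡ {positive} {u} {v} refl same-string) ⟨
    moment positive u + g v   ∎)
    where open ≡-Reasoning

  W : V → ℕ
  W = moment (λ d → d)

  string-≡⇒W-≡ : ∀ {u v} → string G f u ≡ string G f v → W u ≡ W v
  string-≡⇒W-≡ {u} {v} = string-≡⇒moment-≡ {λ d → d} {u} {v} refl

  W-leaf : ∀ t j → W (inj₂ (t , j)) + 2 * g (inj₂ (t , j)) ≡ W (inj₁ t) + total
  W-leaf t j = begin
    W ℓ + 2 * g ℓ                                                    ≡⟨ cong (W ℓ +_) (catSum-indicator ℓ (λ w → 2 * g w)) ⟨
    W ℓ + catSum (suc m) L (indicator ℓ (λ w → 2 * g w))             ≡⟨ catSum-distrib (λ w → δ ℓ w * g w) (indicator ℓ (λ w → 2 * g w)) ⟨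
    catSum (suc m) L (λ w → δ ℓ w * g w + indicator ℓ (λ w → 2 * g w) w)  ≡⟨ catSum-cong pointwise ⟩
    catSum (suc m) L (λ w → δ (inj₁ t) w * g w + g w)                ≡⟨ catSum-distrib (λ w → δ (inj₁ t) w * g w) g ⟩
    W (inj₁ t) + total                                               ∎
    where
    open ≡-Reasoning
    ℓ = inj₂ (t , j)
    pointwise : ∀ w → δ ℓ w * g w + indicator ℓ (λ w → 2 * g w) w ≡ δ (inj₁ t) w * g w + g w
    pointwise w with w ≟V ℓ
    ... | yes refl rewrite δ-refl w | δ-spine-leaf t j = solve 1 (λ x → con 0 :* x :+ con 2 :* x := con 1 :* x :+ x) refl (g w)
    ... | no  w≢ℓ  rewrite δ-≢ {ℓ} {w} (w≢ℓ ∘ sym) | δ-from-spine t w =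
      solve 3 (λ a d x → (a :+ (con 1 :+ d)) :* x :+ con 0 := (a :+ d) :* x :+ x) refl ∣ toℕ t - pos w ∣ (depth w) (g w)

  W₀ W₁ : Fin (suc m) → ℕ
  W₀ t = catSum (suc m) L (λ w → δ (inj₁ t) w)
  W₁ t = catSum (suc m) L (λ w → δ (inj₁ t) w * c w)

  W-spine : ∀ t → W (inj₁ t) ≡ N * W₀ t + W₁ t
  W-spine t = begin
    catSum (suc m) L (λ w → δ (inj₁ t) w * (N + c w))                       ≡⟨ catSum-cong (λ w → expand (δ (inj₁ t) w) N (c w)) ⟩
    catSum (suc m) L (λ w → N * δ (inj₁ t) w + δ (inj₁ t) w * c w)         ≡⟨ catSum-distrib (λ w → N * δ (inj₁ t) w) (λ w → δ (inj₁ t) w * c w) ⟩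
    catSum (suc m) L (λ w → N * δ (inj₁ t) w) + W₁ t                       ≡⟨ cong (_+ W₁ t) (catSum-scale N (δ (inj₁ t))) ⟩
    N * W₀ t + W₁ t                                                         ∎
    where
    open ≡-Reasoning
    expand = solve 3 (λ d x y → d :* (x :+ y) := x :* d :+ d :* y) refl

  W₁<N : ∀ t → W₁ t < N
  W₁<N t = s≤s (begin
    W₁ t                                        ≤⟨ catSum-mono (λ w → ℕ.*-monoˡ-≤ (c w) (δ≤1+n (inj₁ t) w)) ⟩
    catSum (suc m) L (λ w → (2 + m) * c w)      ≡⟨ catSum-scale (2 + m) c ⟩
    (2 + m) * catSum (suc m) L c                ≤⟨ ℕ.n≤1+n _ ⟩
    suc ((2 + m) * catSum (suc m) L c)          ∎)
    where open ℕ.≤-Reasoning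

  module W₀-weights = SymmetricWeights m (λ i → suc (L i)) (λ i → cong suc (sym (L-sym i)))
  open W₀-weights.StrictConvexity (λ _ → s≤s z≤n) using (F; F-injective-up-to-reflection)

  W₀≡F+∑L : ∀ t → W₀ t ≡ F (toℕ t) + sum L
  W₀≡F+∑L t = begin
    W₀ t                                                                     ≡⟨ catSum-cong (δ-from-spine t) ⟩
    sum (λ i → (∣ toℕ t - toℕ i ∣ + 0) + sum {L i} (λ _ → ∣ toℕ t - toℕ i ∣ + 1))
      ≡⟨ sum-cong-≗ (λ i → trans (cong ((∣ toℕ t - toℕ i ∣ + 0) +_) (sum-const (L i) _)) (pointwise (∣ toℕ t - toℕ i ∣) (L i))) ⟩
    sum (λ i → suc (L i) * ∣ toℕ t - toℕ i ∣ + L i)                         ≡⟨ ∑-distrib-+ (λ i → suc (L i) * ∣ toℕ t - toℕ i ∣) L ⟩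
    F (toℕ t) + sum L                                                         ∎
    where
    open ≡-Reasoning
    pointwise : ∀ x l → (x + 0) + l * (x + 1) ≡ suc l * x + l
    pointwise = solve 2 (λ x l → (x :+ con 0) :+ l :* (x :+ con 1) := (con 1 :+ l) :* x :+ l) refl

  J : Fin (suc m) → ℕ
  J i = sum {L i} toℕ

  module W₁-weights = SymmetricWeights m J (λ i → cong (λ k → sum {k} toℕ) (sym (L-sym i)))

  R : ℕ → ℕ
  R a = sum (λ i → J i * suc ∣ a - toℕ i ∣)

  W₁≡t+R : ∀ t → W₁ t ≡ toℕ t + R (toℕ t)
  W₁≡t+R t = begin
    W₁ t
      ≡⟨ ∑-distrib-+ (λ i → δ (inj₁ t) (inj₁ i) * c (inj₁ i)) (λ i → sum (λ j → δ (inj₁ t) (inj₂ (i , j)) * toℕ j)) ⟩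
    sum (λ i → δ (inj₁ t) (inj₁ i) * c (inj₁ i)) + sum (λ i → sum (λ j → δ (inj₁ t) (inj₂ (i , j)) * toℕ j))
      ≡⟨ cong₂ _+_ spine-part (sum-cong-≗ leaf-part) ⟩
    toℕ t + R (toℕ t) ∎
    where
    open ≡-Reasoning
    only-s₀ : ∀ i → ¬ i ≡ zero → δ (inj₁ t) (inj₁ i) * c (inj₁ i) ≡ 0
    only-s₀ zero    0≢0 = ⊥-elim (0≢0 refl)
    only-s₀ (suc i) _   = ℕ.*-zeroʳ (δ (inj₁ t) (inj₁ (suc i)))
    spine-part : sum (λ i → δ (inj₁ t) (inj₁ i) * c (inj₁ i)) ≡ toℕ t
    spine-part = begin
      sum (λ i → δ (inj₁ t) (inj₁ i) * c (inj₁ i))  ≡⟨ sum-single (λ i → δ (inj₁ t) (inj₁ i) * c (inj₁ i)) zero only-s₀ ⟩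
      δ (inj₁ t) (inj₁ zero) * 1                    ≡⟨ trans (ℕ.*-identityʳ _) (δ-from-spine t (inj₁ zero)) ⟩
      ∣ toℕ t - 0 ∣ + 0                             ≡⟨ trans (ℕ.+-identityʳ _) (ℕ.∣-∣-identityʳ (toℕ t)) ⟩
      toℕ t                                         ∎
    leaf-part : ∀ i → sum (λ j → δ (inj₁ t) (inj₂ (i , j)) * toℕ j) ≡ J i * suc ∣ toℕ t - toℕ i ∣
    leaf-part i = begin
      sum {L i} (λ j → δ (inj₁ t) (inj₂ (i , j)) * toℕ j)    ≡⟨ sum-cong-≗ {L i} (λ j → cong (_* toℕ j) (δ-from-spine t (inj₂ (i , j)))) ⟩
      sum {L i} (λ j → (∣ toℕ t - toℕ i ∣ + 1) * toℕ j)      ≡⟨ *-distribˡ-sum {L i} (∣ toℕ t - toℕ i ∣ + 1) toℕ ⟨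
      (∣ toℕ t - toℕ i ∣ + 1) * J i                    ≡⟨ trans (ℕ.*-comm _ (J i)) (cong (J i *_) (ℕ.+-comm _ 1)) ⟩
      J i * suc ∣ toℕ t - toℕ i ∣                      ∎

  spine-injective : ∀ t s → W (inj₁ t) ≡ W (inj₁ s) → t ≡ s
  spine-injective t s Wt≡Ws = Fin.toℕ-injective (untangle (F-injective-up-to-reflection t s Ft≡Fs))
    where
    decomposed : N * W₀ t + W₁ t ≡ N * W₀ s + W₁ s
    decomposed = trans (sym (W-spine t)) (trans Wt≡Ws (W-spine s))
    W₀t≡W₀s : W₀ t ≡ W₀ s
    W₀t≡W₀s = N*a+b≡N*c+d⇒a≡c N (W₁<N t) (W₁<N s) decomposed
    W₁t≡W₁s : W₁ t ≡ W₁ s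
    W₁t≡W₁s = ℕ.+-cancelˡ-≡ (N * W₀ t) _ _ (trans decomposed (cong (λ k → N * k + W₁ s) (sym W₀t≡W₀s)))
    Ft≡Fs : F (toℕ t) ≡ F (toℕ s)
    Ft≡Fs = ℕ.+-cancelʳ-≡ _ _ _ (trans (sym (W₀≡F+∑L t)) (trans W₀t≡W₀s (W₀≡F+∑L s)))
    -- W₀ fixes t only up to t ↦ m - t, which leaves R unchanged; so W₁ t = t + R t decides.
    untangle : toℕ t ≡ toℕ s ⊎ toℕ t + toℕ s ≡ m → toℕ t ≡ toℕ s
    untangle (inj₁ t≡s)   = t≡s
    untangle (inj₂ t+s≡m) = ℕ.+-cancelʳ-≡ (R (toℕ t)) _ _ (begin
      toℕ t + R (toℕ t)   ≡⟨ W₁≡t+R t ⟨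
      W₁ t                ≡⟨ W₁t≡W₁s ⟩
      W₁ s                ≡⟨ W₁≡t+R s ⟩
      toℕ s + R (toℕ s)   ≡⟨ cong (λ k → toℕ s + R k) s≡m∸t ⟩
      toℕ s + R (m ∸ toℕ t) ≡⟨ cong (toℕ s +_) (W₁-weights.∑-reflect suc (Fin.toℕ≤pred[n] t)) ⟨
      toℕ s + R (toℕ t)   ∎)
      where
      open ≡-Reasoning
      s≡m∸t : toℕ s ≡ m ∸ toℕ t
      s≡m∸t = sym (trans (cong (_∸ toℕ t) (sym t+s≡m)) (ℕ.m+n∸m≡n (toℕ t) (toℕ s)))

  c-spine≤1 : ∀ s → c (inj₁ s) ≤ 1
  c-spine≤1 zero    = ℕ.≤-refl
  c-spine≤1 (suc _) = z≤n

  coordℕ-leaf : ∀ t b → coordℕ (inj₂ (t , b)) 1 ≡ g (inj₁ t)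
  coordℕ-leaf t b = trans (catSum-single (λ w → if δ (inj₂ (t , b)) w ≡ᵇ 1 then g w else 0) (inj₁ t) off-neighbour)
                          (cong (λ d → if d ≡ᵇ 1 then g (inj₁ t) else 0) (δ-leaf-spine t b))
    where
    off-neighbour : ∀ w → ¬ w ≡ inj₁ t → (if δ (inj₂ (t , b)) w ≡ᵇ 1 then g w else 0) ≡ 0
    off-neighbour w w≢s = if-≡ᵇ-≢ (g w) 0 (w≢s ∘ leaf-neighbour t b w)

  coordℕ-spine : ∀ t → TwoNeighbours t → N + N ≤ coordℕ (inj₁ t) 1
  coordℕ-spine t (w₁ , w₂ , w₁≢w₂ , δ₁≡1 , δ₂≡1) =
    ℕ.≤-trans (ℕ.+-mono-≤ (N≤ w₁ δ₁≡1) (N≤ w₂ δ₂≡1)) (catSum-≥-pair (λ w → if δ (inj₁ t) w ≡ᵇ 1 then g w else 0) w₁≢w₂)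
    where
    N≤ : ∀ w → δ (inj₁ t) w ≡ 1 → N ≤ (if δ (inj₁ t) w ≡ᵇ 1 then g w else 0)
    N≤ w δ≡1 rewrite δ≡1 = ℕ.m≤m+n N (c w)

  1≤D : 1 ≤ D
  1≤D = subst (_≤ D) (δ-spine-leaf zero (Fin.fromℕ< L₀≥1)) (δ≤diam (inj₁ zero) (inj₂ (zero , Fin.fromℕ< L₀≥1)))

  spine-string≢leaf-string : ∀ t s b → ¬ string G f (inj₁ t) ≡ string G f (inj₂ (s , b))
  spine-string≢leaf-string t s b same-string with two-neighbours m L L₀≥1 Lₘ≥1 t
  ... | inj₂ neighbours = ℕ.<-irrefl coord₁≡ (begin-strict
    g (inj₁ s)          ≤⟨ ℕ.+-monoʳ-≤ N (c-spine≤1 s) ⟩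
    N + 1               <⟨ ℕ.+-monoʳ-< N (s≤s (s≤s z≤n)) ⟩
    N + N               ≤⟨ coordℕ-spine t neighbours ⟩
    coordℕ (inj₁ t) 1   ∎)
    where
    open ℕ.≤-Reasoning
    coord₁≡ : g (inj₁ s) ≡ coordℕ (inj₁ t) 1
    coord₁≡ = trans (sym (coordℕ-leaf s b)) (sym (coordℕ-≡ {inj₁ t} {inj₂ (s , b)} same-string 0 1≤D))
  ... | inj₁ (m≡0 , L₀≡1) = ℕ.1+n≢0 (ℕ.+-cancelˡ-≡ N 1 0 (begin
    N + 1            ≡⟨ cong (λ x → N + c (inj₁ x)) (sole t) ⟨
    g (inj₁ t)       ≡⟨ string-≡⇒g-≡ {inj₁ t} {inj₂ (s , b)} same-string ⟩
    N + toℕ b        ≡⟨ cong (N +_) (ℕ.n<1⇒n≡0 (subst (toℕ b <_) (trans (cong L (sole s)) L₀≡1) (Fin.toℕ<n b))) ⟩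
    N + 0            ∎))
    where
    open ≡-Reasoning
    sole : ∀ (x : Fin (suc m)) → x ≡ zero
    sole x = Fin.toℕ-injective (ℕ.n≤0⇒n≡0 (subst (toℕ x ≤_) m≡0 (Fin.toℕ≤pred[n] x)))

  leaf-string-≡⇒W-spine-≡ : ∀ t j s k → string G f (inj₂ (t , j)) ≡ string G f (inj₂ (s , k)) → W (inj₁ t) ≡ W (inj₁ s)
  leaf-string-≡⇒W-spine-≡ t j s k same-string = ℕ.+-cancelʳ-≡ total (W (inj₁ t)) (W (inj₁ s)) (begin
    W (inj₁ t) + total                            ≡⟨ W-leaf t j ⟨
    W (inj₂ (t , j)) + 2 * g (inj₂ (t , j))       ≡⟨ cong₂ (λ x y → x + 2 * y) (string-≡⇒W-≡ {inj₂ (t , j)} {inj₂ (s , k)} same-string)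
                                                                           (string-≡⇒g-≡ {inj₂ (t , j)} {inj₂ (s , k)} same-string) ⟩
    W (inj₂ (s , k)) + 2 * g (inj₂ (s , k))       ≡⟨ W-leaf s k ⟩
    W (inj₁ s) + total                            ∎)
    where open ≡-Reasoning

  leaf-index-injective : ∀ t j k → string G f (inj₂ (t , j)) ≡ string G f (inj₂ (t , k)) → j ≡ k
  leaf-index-injective t j k same-string =
    Fin.toℕ-injective (ℕ.+-cancelˡ-≡ N (toℕ j) (toℕ k) (string-≡⇒g-≡ {inj₂ (t , j)} {inj₂ (t , k)} same-string))

  leaves-of-same-spine : ∀ {t s : Fin (suc m)} {j k} → t ≡ s →
    string G f (inj₂ (t , j)) ≡ string G f (inj₂ (s , k)) → _≡_ {A = V} (inj₂ (t , j)) (inj₂ (s , k))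
  leaves-of-same-spine {t} {j = j} {k} refl same-string = cong (λ x → inj₂ (t , x)) (leaf-index-injective t j k same-string)

  distinguishing : Distinguishing G f
  distinguishing (inj₁ t)       (inj₁ s)       same-string = cong inj₁ (spine-injective t s (string-≡⇒W-≡ {inj₁ t} {inj₁ s} same-string))
  distinguishing (inj₁ t)       (inj₂ (s , b)) same-string = ⊥-elim (spine-string≢leaf-string t s b same-string)
  distinguishing (inj₂ (t , b)) (inj₁ s)       same-string = ⊥-elim (spine-string≢leaf-string s t b (sym same-string))
  distinguishing (inj₂ (t , j)) (inj₂ (s , k)) same-string =
    leaves-of-same-spine (spine-injective t s (leaf-string-≡⇒W-spine-≡ t j s k same-string)) same-string

  valueCount : ℕ
  valueCount = maxLeaves (suc m) L ⊔ 2

  c<valueCount : ∀ w → c w < valueCount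
  c<valueCount (inj₁ zero)    = ℕ.m≤n⊔m (maxLeaves (suc m) L) 2
  c<valueCount (inj₁ (suc _)) = ℕ.≤-trans (s≤s z≤n) (ℕ.m≤n⊔m (maxLeaves (suc m) L) 2)
  c<valueCount (inj₂ (i , j)) = ℕ.<-≤-trans (Fin.toℕ<n j) (ℕ.≤-trans (L≤maxLeaves (suc m) L i) (ℕ.m≤m⊔n _ 2))

  c-onto : ∀ j → j < valueCount → Σ V λ w → c w ≡ j
  c-onto zero          _   = inj₂ (zero , Fin.fromℕ< L₀≥1) , Fin.toℕ-fromℕ< L₀≥1
  c-onto (suc zero)    _   = inj₁ zero , refl
  c-onto (suc (suc j)) j< with i , j<Lᵢ ← <maxLeaves⇒<L (suc m) L (<⊔⇒< (s≤s (s≤s z≤n)) j<) =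
    inj₂ (i , Fin.fromℕ< j<Lᵢ) , Fin.toℕ-fromℕ< j<Lᵢ

  numValues-f : numValues G f ≡ valueCount
  numValues-f = trans (numValues≡length G f values-unique values⊆ f∈values) (List.length-applyUpTo value valueCount)
    where
    value : ℕ → ℚ
    value j = toℚ (N + j)
    values-unique : Unique (applyUpTo value valueCount)
    values-unique = Unique.applyUpTo⁺₁ value valueCount λ i<j _ eq → ℕ.<-irrefl (ℕ.+-cancelˡ-≡ N _ _ (toℚ-injective eq)) i<j
    values⊆ : ∀ {x} → x ∈ applyUpTo value valueCount → x ∈ map f verts
    values⊆ x∈ with j , j< , refl ← ∈-applyUpTo⁻ value x∈ with w , refl ← c-onto j j< = ∈-map⁺ f (∈-verts w)
    f∈values : ∀ v → f v ∈ applyUpTo value valueCount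
    f∈values v = ∈-applyUpTo⁺ value (c<valueCount v)

IsIDI-maxLeaves⊔2 : ∀ m (L : Fin (suc m) → ℕ) → 1 ≤ L zero → 1 ≤ L (fromℕ m) → (∀ j → L j ≡ L (opposite j)) →
                    IsIDI (caterpillar (suc m) L) (maxLeaves (suc m) L ⊔ 2)
IsIDI-maxLeaves⊔2 m L L₀≥1 Lₘ≥1 L-sym = (f , distinguishing , numValues-f) , lower-bound
  where
  open Construction m L L₀≥1 Lₘ≥1 L-sym using (f; distinguishing; numValues-f)
  lower-bound : ∀ f′ → Distinguishing (caterpillar (suc m) L) f′ → maxLeaves (suc m) L ⊔ 2 ≤ numValues (caterpillar (suc m) L) f′
  lower-bound f′ distinguishing′ = ℕ.⊔-lub
    (maxLeaves-lub (suc m) L (CaterpillarSymmetry.Distinguishing⇒L≤numValues (suc m) L f′ distinguishing′))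
    (Distinguishing⇒2≤numValues m L L₀≥1 L-sym f′ distinguishing′)

theorem9 : (m : ℕ) (L : Fin (suc m) → ℕ)
    → 1 ≤ L zero → 1 ≤ L (fromℕ m)
    → (∀ j → L j ≡ L (opposite j))
    → (2 ≤ maxLeaves (suc m) L → IsIDI (caterpillar (suc m) L) (maxLeaves (suc m) L))
    × (maxLeaves (suc m) L ≡ 1 → IsIDI (caterpillar (suc m) L) 2)
theorem9 m L L₀≥1 Lₘ≥1 L-sym =
    (λ 2≤M → subst (IsIDI G) (ℕ.m≥n⇒m⊔n≡m 2≤M) idi)
  , (λ M≡1 → subst (IsIDI G) (cong (_⊔ 2) M≡1) idi)
  where
  G = caterpillar (suc m) L
  idi = IsIDI-maxLeaves⊔2 m L L₀≥1 Lₘ≥1 L-sym
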